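{- Let $G$ be a $C_{4k}$-free bipartite graph. Then $G$ has a unique maximum independent set if and only if $G=C_S(G)$.
   Context: All graphs are finite, simple and undirected. A graph is a $C_{4k}$-free bipartite graph if it is bipartite and contains no cycle whose length is a multiple of $4$. For a graph $G$, $\operatorname{Null}(G)$ is the null space of its adjacency matrix, viewed as a subspace of $\mathbb{R}^{V(G)}$; $\operatorname{Supp}(G)$ is the set of vertices $v$ with $\vec{x}_v\neq0$ for some $\vec{x}\in\operatorname{Null}(G)$; $\operatorname{Core}(G)$ is the set of vertices adjacent to some vertex of $\operatorname{Supp}(G)$. $C_S(G)$ is the subgraph of $G$ induced by $\operatorname{Supp}(G)\cup\operatorname{Core}(G)$.
   Formalization: The null space $\operatorname{Null}(G)$ is taken over ℚ instead of ℝ, so $\operatorname{Supp}(G)$, $\operatorname{Core}(G)$ and $C_S(G)$ are determined by rational vectors. -}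

module Defs where

open import Data.Nat using (ℕ; zero; suc; _≤_)
open import Data.Nat.Divisibility using (_∣_)
open import Data.Fin using (Fin; zero; suc; inject₁; fromℕ)
open import Data.Fin.Subset using (Subset; _∈_; ∣_∣)
open import Data.Bool using (Bool; true; false; if_then_else_)
open import Data.Rational using (ℚ; 0ℚ; 1ℚ; _+_; _*_)
open import Data.Product using (Σ; _×_; ∃)
open import Data.Sum using (_⊎_)
open import Data.Empty using (⊥)
open import Relation.Nullary using (¬_)
open import Relation.Binary.PropositionalEquality using (_≡_; _≢_)
open import Function.Definitions using (Injective)

record Graph (n : ℕ) : Set where
  field
    adj    : Fin n → Fin n → Bool
    sym    : ∀ i j → adj i j ≡ adj j i
    irrefl : ∀ i → adj i i ≡ false
open Graph public

Adj : ∀ {n} → Graph n → Fin n → Fin n → Set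
Adj G i j = adj G i j ≡ true

Bipartite : ∀ {n} → Graph n → Set
Bipartite {n} G = Σ (Fin n → Bool) λ c → ∀ i j → Adj G i j → c i ≢ c j

-- A cycle of length (suc m): distinct vertices f 0, …, f m with f i ~ f (i+1)
-- and f m ~ f 0.
IsCycle : ∀ {n} → Graph n → (m : ℕ) → (Fin (suc m) → Fin n) → Set
IsCycle G m f =
  Injective _≡_ _≡_ f
  × (∀ (i : Fin m) → Adj G (f (inject₁ i)) (f (suc i)))
  × Adj G (f (fromℕ m)) (f zero)

C4kFree : ∀ {n} → Graph n → Set
C4kFree {n} G = ∀ (m : ℕ) (f : Fin (suc m) → Fin n) → 4 ∣ suc m → ¬ IsCycle G m f

Independent : ∀ {n} → Graph n → Subset n → Set
Independent G S = ∀ i j → i ∈ S → j ∈ S → ¬ Adj G i j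

MaximumIndependent : ∀ {n} → Graph n → Subset n → Set
MaximumIndependent {n} G S =
  Independent G S × (∀ (T : Subset n) → Independent G T → ∣ T ∣ ≤ ∣ S ∣)

HasUniqueMaximumIndependentSet : ∀ {n} → Graph n → Set
HasUniqueMaximumIndependentSet {n} G =
  Σ (Subset n) λ S → MaximumIndependent G S × (∀ T → MaximumIndependent G T → T ≡ S)

sumℚ : ∀ {n} → (Fin n → ℚ) → ℚ
sumℚ {zero}  f = 0ℚ
sumℚ {suc n} f = f zero + sumℚ (λ i → f (suc i))

adjMatrix : ∀ {n} → Graph n → Fin n → Fin n → ℚ
adjMatrix G i j = if adj G i j then 1ℚ else 0ℚ

InNull : ∀ {n} → Graph n → (Fin n → ℚ) → Set
InNull G x = ∀ i → sumℚ (λ j → adjMatrix G i j * x j) ≡ 0ℚ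

InSupp : ∀ {n} → Graph n → Fin n → Set
InSupp {n} G v = Σ (Fin n → ℚ) λ x → InNull G x × x v ≢ 0ℚ

InCore : ∀ {n} → Graph n → Fin n → Set
InCore {n} G v = Σ (Fin n) λ u → Adj G v u × InSupp G u

-- G = C_S(G): the subgraph induced by Supp ∪ Core is all of G,
-- i.e. every vertex lies in Supp(G) ∪ Core(G).
EqualsCS : ∀ {n} → Graph n → Set
EqualsCS G = ∀ v → InSupp G v ⊎ InCore G v

module Submission where

open import Defs hiding (sym)
open import Data.Nat using (ℕ)
open import Data.Fin using (Fin; zero; suc)
open import Data.Bool using (Bool; true; false; if_then_else_; not; _∧_; _∨_)
open import Data.Product using (Σ; Σ-syntax; ∃; _×_; _,_; proj₁; proj₂)
open import Data.Sum using (_⊎_; inj₁; inj₂)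
open import Data.Empty using (⊥; ⊥-elim)
open import Relation.Nullary using (¬_; Dec; yes; no; does)
open import Relation.Binary.PropositionalEquality
open import Function.Bundles using (_⇔_; mk⇔)

-- Let T be a maximum independent set, v ∉ T, and B the vertices outside T of the
-- colour of v.  For W ⊆ B the set (T ∖ N(W)) ∪ W is independent, so W has at least
-- |W| neighbours in T, and Hall's theorem matches B into T.  The square block of the
-- adjacency matrix with the matched vertices of T as rows and B as columns is
-- nonsingular: two perfect matchings of it differ by alternating cycles, whose
-- lengths are 2 mod 4 as G has no cycle of length divisible by 4, so all nonzero
-- terms of its Leibniz expansion have the same sign.  Every neighbour of a matched
-- vertex of T lies in B, so a null vector restricted to B solves the homogeneous
-- block system and vanishes at v.  Hence Supp(G) lies in every maximum independent
-- set and, by independence, Core(G) in none, which gives uniqueness when G = C_S(G).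
-- Conversely, if S is the unique maximum independent set and v ∈ S, uniqueness makes
-- the exchange inequality strict, so the vertices outside S of the other colour can
-- be matched into S ∖ {v}; solving the block system against the column of v yields
-- a null vector with value 1 at v.  A vertex outside S has a neighbour in S, since S
-- is maximum, and so lies in Core(G).

module FiniteSums where

  open import Data.Nat as ℕ using (ℕ)
  open import Data.Sum using ([_,_]′)
  open import Function using (id; _∘_)
  open import Data.Fin using (punchIn)
  import Data.Fin.Properties as Fin
  open import Data.Rational using (ℚ; 0ℚ; 1ℚ; _+_; _*_; -_; 1/_; NonZero; ≢-nonZero; _≤_; _<_)
  open import Data.Rational.Properties
  open import Data.Rational.Solver using (module +-*-Solver)
  open +-*-Solver
  import Algebra.Properties.CommutativeMonoid.Sum as CommutativeMonoidSum
  open import Data.Fin.Permutation.Components using (transpose)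
  import Data.Fin.Permutation as Permutation

  p*q≡0⇒p≡0∨q≡0 : ∀ p q → p * q ≡ 0ℚ → p ≡ 0ℚ ⊎ q ≡ 0ℚ
  p*q≡0⇒p≡0∨q≡0 p q pq≡0 with p ≟ 0ℚ
  ... | yes p≡0 = inj₁ p≡0
  ... | no p≢0 = inj₂ (begin
      q                 ≡⟨ *-identityˡ q ⟨
      1ℚ * q            ≡⟨ cong (_* q) (*-inverseˡ p) ⟨
      (1/ p * p) * q    ≡⟨ *-assoc (1/ p) p q ⟩
      1/ p * (p * q)    ≡⟨ cong (1/ p *_) pq≡0 ⟩
      1/ p * 0ℚ         ≡⟨ *-zeroʳ (1/ p) ⟩
      0ℚ                ∎)
    where
    open ≡-Reasoning
    instance
      _ : NonZero p
      _ = ≢-nonZero p≢0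

  p*q≢0 : ∀ {p q} → p ≢ 0ℚ → q ≢ 0ℚ → p * q ≢ 0ℚ
  p*q≢0 {p} {q} p≢0 q≢0 = [ p≢0 , q≢0 ]′ ∘ p*q≡0⇒p≡0∨q≡0 p q

  p≡-p⇒p≡0 : ∀ p → p ≡ - p → p ≡ 0ℚ
  p≡-p⇒p≡0 p p≡-p = [ (λ ()) , id ]′ (p*q≡0⇒p≡0∨q≡0 (1ℚ + 1ℚ) p 2p≡0)
    where
    open ≡-Reasoning
    2p≡0 : (1ℚ + 1ℚ) * p ≡ 0ℚ
    2p≡0 = begin
      (1ℚ + 1ℚ) * p  ≡⟨ solve 1 (λ x → (con 1ℚ :+ con 1ℚ) :* x := x :+ x) refl p ⟩
      p + p          ≡⟨ cong (p +_) p≡-p ⟩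
      p + - p        ≡⟨ +-inverseʳ p ⟩
      0ℚ             ∎

  Matrix : ℕ → Set
  Matrix n = Fin n → Fin n → ℚ

  infixl 7 _·_
  _·_ : ∀ {m n} → (Fin m → Fin n → ℚ) → (Fin n → ℚ) → Fin m → ℚ
  (M · y) i = sumℚ (λ j → M i j * y j)

  sumℚ-cong : ∀ {n} {f g : Fin n → ℚ} → (∀ i → f i ≡ g i) → sumℚ f ≡ sumℚ g
  sumℚ-cong {ℕ.zero} f≗g = refl
  sumℚ-cong {ℕ.suc n} f≗g = cong₂ _+_ (f≗g zero) (sumℚ-cong (λ i → f≗g (suc i)))

  sumℚ-zero : ∀ {n} {f : Fin n → ℚ} → (∀ i → f i ≡ 0ℚ) → sumℚ f ≡ 0ℚ
  sumℚ-zero {ℕ.zero} f≡0 = refl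
  sumℚ-zero {ℕ.suc n} f≡0 = trans (cong₂ _+_ (f≡0 zero) (sumℚ-zero (λ i → f≡0 (suc i)))) (+-identityˡ 0ℚ)

  sumℚ-+ : ∀ {n} (f g : Fin n → ℚ) → sumℚ (λ i → f i + g i) ≡ sumℚ f + sumℚ g
  sumℚ-+ {ℕ.zero} f g = refl
  sumℚ-+ {ℕ.suc n} f g =
    trans (cong (f zero + g zero +_) (sumℚ-+ (λ i → f (suc i)) (λ i → g (suc i))))
          (solve 4 (λ a b c d → (a :+ b) :+ (c :+ d) := (a :+ c) :+ (b :+ d)) refl
                 (f zero) (g zero) (sumℚ (λ i → f (suc i))) (sumℚ (λ i → g (suc i))))

  sumℚ-*ˡ : ∀ {n} (a : ℚ) (f : Fin n → ℚ) → sumℚ (λ i → a * f i) ≡ a * sumℚ f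
  sumℚ-*ˡ {ℕ.zero} a f = sym (*-zeroʳ a)
  sumℚ-*ˡ {ℕ.suc n} a f = trans (cong (a * f zero +_) (sumℚ-*ˡ a (λ i → f (suc i))))
                                (sym (*-distribˡ-+ a (f zero) (sumℚ (λ i → f (suc i)))))

  sumℚ-neg : ∀ {n} (f : Fin n → ℚ) → sumℚ (λ i → - f i) ≡ - sumℚ f
  sumℚ-neg {ℕ.zero} f = refl
  sumℚ-neg {ℕ.suc n} f = trans (cong (- f zero +_) (sumℚ-neg (λ i → f (suc i))))
                               (sym (neg-distrib-+ (f zero) (sumℚ (λ i → f (suc i)))))

  sumℚ-swap : ∀ {m n} (F : Fin m → Fin n → ℚ) →
    sumℚ (λ i → sumℚ (F i)) ≡ sumℚ (λ j → sumℚ (λ i → F i j))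
  sumℚ-swap {ℕ.zero} {n} F = sym (sumℚ-zero {n} (λ j → refl))
  sumℚ-swap {ℕ.suc m} F = trans (cong (sumℚ (F zero) +_) (sumℚ-swap (λ i → F (suc i))))
                                (sym (sumℚ-+ (F zero) (λ j → sumℚ (λ i → F (suc i) j))))

  sumℚ-single : ∀ {n} (f : Fin n → ℚ) (k : Fin n) → (∀ i → i ≢ k → f i ≡ 0ℚ) → sumℚ f ≡ f k
  sumℚ-single f zero f≡0 =
    trans (cong (f zero +_) (sumℚ-zero (λ i → f≡0 (suc i) (λ ())))) (+-identityʳ (f zero))
  sumℚ-single f (suc k) f≡0 =
    trans (cong₂ _+_ (f≡0 zero (λ ())) (sumℚ-single (λ i → f (suc i)) k (λ i i≢k → f≡0 (suc i) (i≢k ∘ Fin.suc-injective))))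
          (+-identityˡ (f (suc k)))

  sumℚ-punchIn : ∀ {n} (f : Fin (ℕ.suc n) → ℚ) (j : Fin (ℕ.suc n)) →
    sumℚ f ≡ f j + sumℚ (λ l → f (punchIn j l))
  sumℚ-punchIn f zero = refl
  sumℚ-punchIn {ℕ.suc n} f (suc j) =
    trans (cong (f zero +_) (sumℚ-punchIn (λ i → f (suc i)) j))
          (solve 3 (λ a b c → a :+ (b :+ c) := b :+ (a :+ c)) refl (f zero) (f (suc j)) (sumℚ (λ l → f (suc (punchIn j l)))))

  sumℚ-nonneg : ∀ {n} (f : Fin n → ℚ) → (∀ i → 0ℚ ≤ f i) → 0ℚ ≤ sumℚ f
  sumℚ-nonneg {ℕ.zero} f f≥0 = ≤-refl
  sumℚ-nonneg {ℕ.suc n} f f≥0 = +-mono-≤ (f≥0 zero) (sumℚ-nonneg (λ i → f (suc i)) (λ i → f≥0 (suc i)))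

  sumℚ-pos : ∀ {n} (f : Fin n → ℚ) → (∀ i → 0ℚ ≤ f i) → (k : Fin n) → 0ℚ < f k → 0ℚ < sumℚ f
  sumℚ-pos f f≥0 zero fk>0 = +-mono-<-≤ fk>0 (sumℚ-nonneg (λ i → f (suc i)) (λ i → f≥0 (suc i)))
  sumℚ-pos f f≥0 (suc k) fk>0 = +-mono-≤-< (f≥0 zero) (sumℚ-pos (λ i → f (suc i)) (λ i → f≥0 (suc i)) k fk>0)

  open CommutativeMonoidSum *-1-commutativeMonoid public
    using () renaming (sum to prodℚ)
  open CommutativeMonoidSum *-1-commutativeMonoid
    using () renaming (sum-permute to prodℚ-permute)

  prodℚ-cong : ∀ {n} {f g : Fin n → ℚ} → (∀ i → f i ≡ g i) → prodℚ f ≡ prodℚ g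
  prodℚ-cong {ℕ.zero} f≗g = refl
  prodℚ-cong {ℕ.suc n} f≗g = cong₂ _*_ (f≗g zero) (prodℚ-cong (λ i → f≗g (suc i)))

  prodℚ-zero : ∀ {n} (f : Fin n → ℚ) (k : Fin n) → f k ≡ 0ℚ → prodℚ f ≡ 0ℚ
  prodℚ-zero f zero fk≡0 = trans (cong (_* prodℚ (λ i → f (suc i))) fk≡0) (*-zeroˡ (prodℚ (λ i → f (suc i))))
  prodℚ-zero f (suc k) fk≡0 = trans (cong (f zero *_) (prodℚ-zero (λ i → f (suc i)) k fk≡0)) (*-zeroʳ (f zero))

  prodℚ-one : ∀ {n} (f : Fin n → ℚ) → (∀ i → f i ≡ 1ℚ) → prodℚ f ≡ 1ℚ
  prodℚ-one {ℕ.zero} f f≡1 = refl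
  prodℚ-one {ℕ.suc n} f f≡1 = cong₂ _*_ (f≡1 zero) (prodℚ-one (λ i → f (suc i)) (λ i → f≡1 (suc i)))

  prodℚ-≢0 : ∀ {n} (f : Fin n → ℚ) → (∀ i → f i ≢ 0ℚ) → prodℚ f ≢ 0ℚ
  prodℚ-≢0 {ℕ.zero} f f≢0 = λ ()
  prodℚ-≢0 {ℕ.suc n} f f≢0 = p*q≢0 (f≢0 zero) (prodℚ-≢0 (λ i → f (suc i)) (λ i → f≢0 (suc i)))

  prodℚ-extract : ∀ {n} (f : Fin n → ℚ) (k : Fin n) →
    prodℚ f ≡ f k * prodℚ (λ j → if does (j Fin.≟ k) then 1ℚ else f j)
  prodℚ-extract f zero = cong (f zero *_) (sym (*-identityˡ _))
  prodℚ-extract f (suc k) = begin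
    f zero * prodℚ (λ i → f (suc i))
      ≡⟨ cong (f zero *_) (prodℚ-extract (λ i → f (suc i)) k) ⟩
    f zero * (f (suc k) * rest)
      ≡⟨ solve 3 (λ a b c → a :* (b :* c) := b :* (a :* c)) refl (f zero) (f (suc k)) rest ⟩
    f (suc k) * (f zero * rest) ∎
    where
    open ≡-Reasoning
    rest = prodℚ (λ j → if does (j Fin.≟ k) then 1ℚ else f (suc j))

  prodℚ-transpose : ∀ {n} (f : Fin n → ℚ) (a b : Fin n) → prodℚ (λ j → f (transpose a b j)) ≡ prodℚ f
  prodℚ-transpose f a b = sym (prodℚ-permute f (Permutation.transpose a b))

module Transpositions where

  open import Data.Nat as ℕ using (ℕ)
  import Data.Fin.Properties as Fin
  open import Data.Fin.Permutation using (lift₀-transpose)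
  open import Data.Fin.Permutation.Components public using (transpose)
  open import Data.Fin.Permutation.Components using (transpose-inverse)
  open import Relation.Nullary.Decidable using (dec-true; dec-false)

  transpose-matchˡ : ∀ {n} (i j : Fin n) → transpose i j i ≡ j
  transpose-matchˡ i j rewrite dec-true (i Fin.≟ i) refl = refl

  transpose-matchʳ : ∀ {n} (i j : Fin n) → transpose i j j ≡ i
  transpose-matchʳ i j with j Fin.≟ i
  ... | yes j≡i = j≡i
  ... | no _ rewrite dec-true (j Fin.≟ j) refl = refl

  transpose-other : ∀ {n} {i j k : Fin n} → k ≢ i → k ≢ j → transpose i j k ≡ k
  transpose-other {i = i} {j} {k} k≢i k≢j
    rewrite dec-false (k Fin.≟ i) k≢i | dec-false (k Fin.≟ j) k≢j = refl

  transpose-cases : ∀ {n} (i j k : Fin n) → k ≡ i ⊎ k ≡ j ⊎ (k ≢ i × k ≢ j)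
  transpose-cases i j k with k Fin.≟ i | k Fin.≟ j
  ... | yes k≡i | _ = inj₁ k≡i
  ... | no _ | yes k≡j = inj₂ (inj₁ k≡j)
  ... | no k≢i | no k≢j = inj₂ (inj₂ (k≢i , k≢j))

  transpose-comm : ∀ {n} (i j k : Fin n) → transpose i j k ≡ transpose j i k
  transpose-comm i j k with transpose-cases i j k
  ... | inj₁ refl = trans (transpose-matchˡ k j) (sym (transpose-matchʳ j k))
  ... | inj₂ (inj₁ refl) = trans (transpose-matchʳ i k) (sym (transpose-matchˡ k i))
  ... | inj₂ (inj₂ (k≢i , k≢j)) = trans (transpose-other k≢i k≢j) (sym (transpose-other k≢j k≢i))

  transpose-involutive : ∀ {n} (i j k : Fin n) → transpose i j (transpose i j k) ≡ k
  transpose-involutive i j k = trans (cong (transpose i j) (transpose-comm i j k)) (transpose-inverse i j)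

  transpose-suc : ∀ {n} (i j k : Fin n) → transpose (suc i) (suc j) (suc k) ≡ suc (transpose i j k)
  transpose-suc i j k = lift₀-transpose i j (suc k)

  transpose-conj : ∀ {n} (b : Fin n) (j : Fin (ℕ.suc (ℕ.suc n))) →
    transpose zero (suc (suc b)) j ≡
    transpose zero (suc zero) (transpose (suc zero) (suc (suc b)) (transpose zero (suc zero) j))
  transpose-conj b zero = refl
  transpose-conj b (suc zero) = refl
  transpose-conj b (suc (suc j)) with j Fin.≟ b
  ... | yes refl = refl
  ... | no j≢b = refl

module Determinants where

  open FiniteSums
  open Transpositions
  open import Data.Nat as ℕ using (ℕ)
  open import Function using (_∘_; id)
  open import Data.Sum using ([_,_]′)
  import Data.Fin.Properties as Fin
  open import Data.Vec.Functional using (_∷_; tail)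
  open import Data.Rational using (ℚ; 0ℚ; 1ℚ; _+_; _*_; -_; _≤_; _<_)
  open import Data.Rational.Properties using (*-zeroˡ; *-zeroʳ; neg-distribˡ-*; neg-distribʳ-*; *-comm; +-0-group)
  open import Algebra.Properties.Group +-0-group using (⁻¹-involutive)
  open import Data.Rational.Solver using (module +-*-Solver)
  open +-*-Solver
  open import Relation.Nullary.Decidable using (dec-true; dec-false)

  orientation : ∀ {n} → Fin n → Fin n → ℚ
  orientation zero zero = 0ℚ
  orientation zero (suc _) = 1ℚ
  orientation (suc _) zero = - 1ℚ
  orientation (suc a) (suc b) = orientation a b

  orientation-antisym : ∀ {n} (a b : Fin n) → orientation b a ≡ - orientation a b
  orientation-antisym zero zero = refl
  orientation-antisym zero (suc b) = refl
  orientation-antisym (suc a) zero = refl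
  orientation-antisym (suc a) (suc b) = orientation-antisym a b

  orientation-refl : ∀ {n} (a : Fin n) → orientation a a ≡ 0ℚ
  orientation-refl zero = refl
  orientation-refl (suc a) = orientation-refl a

  orientation≡0⇒≡ : ∀ {n} (a b : Fin n) → orientation a b ≡ 0ℚ → a ≡ b
  orientation≡0⇒≡ zero zero _ = refl
  orientation≡0⇒≡ (suc a) (suc b) o≡0 = cong suc (orientation≡0⇒≡ a b o≡0)

  -- ±1, the sign of the permutation, when f is bijective; 0 when f is not injective.
  sign : ∀ {m n} → (Fin m → Fin n) → ℚ
  leadingSign : ∀ {m n} → (Fin (ℕ.suc m) → Fin n) → ℚ

  sign {ℕ.zero} f = 1ℚ
  sign {ℕ.suc m} f = leadingSign f * sign (tail f)

  leadingSign f = prodℚ (λ j → orientation (f zero) (f (suc j)))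

  sign-cong : ∀ {m n} {f g : Fin m → Fin n} → (∀ j → f j ≡ g j) → sign f ≡ sign g
  sign-cong {ℕ.zero} f≗g = refl
  sign-cong {ℕ.suc m} f≗g =
    cong₂ _*_ (prodℚ-cong (λ j → cong₂ orientation (f≗g zero) (f≗g (suc j))))
              (sign-cong (λ j → f≗g (suc j)))

  sign≢0⇒injective : ∀ {m n} (f : Fin m → Fin n) → sign f ≢ 0ℚ → ∀ a b → f a ≡ f b → a ≡ b
  sign≢0⇒injective f _ zero zero _ = refl
  sign≢0⇒injective f sf≢0 zero (suc b) fa≡fb = ⊥-elim (sf≢0 (begin
    leadingSign f * sign (tail f)  ≡⟨ cong (_* sign (tail f)) leading≡0 ⟩
    0ℚ * sign (tail f)             ≡⟨ *-zeroˡ (sign (tail f)) ⟩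
    0ℚ                             ∎))
    where
    open ≡-Reasoning
    leading≡0 : leadingSign f ≡ 0ℚ
    leading≡0 = prodℚ-zero (λ j → orientation (f zero) (f (suc j))) b
      (trans (cong (orientation (f zero)) (sym fa≡fb)) (orientation-refl (f zero)))
  sign≢0⇒injective f sf≢0 (suc a) zero fa≡fb = sym (sign≢0⇒injective f sf≢0 zero (suc a) (sym fa≡fb))
  sign≢0⇒injective f sf≢0 (suc a) (suc b) fa≡fb =
    cong suc (sign≢0⇒injective (tail f) (λ s≡0 → sf≢0 (trans (cong (leadingSign f *_) s≡0) (*-zeroʳ (leadingSign f)))) a b fa≡fb)

  injective⇒sign≢0 : ∀ {m n} (f : Fin m → Fin n) → (∀ a b → f a ≡ f b → a ≡ b) → sign f ≢ 0ℚ
  injective⇒sign≢0 {ℕ.zero} f _ = λ ()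
  injective⇒sign≢0 {ℕ.suc m} f f-inj =
    p*q≢0 (prodℚ-≢0 _ (λ j o≡0 → distinct j (orientation≡0⇒≡ _ _ o≡0)))
         (injective⇒sign≢0 (tail f) (λ a b e → Fin.suc-injective (f-inj (suc a) (suc b) e)))
    where
    distinct : ∀ j → f zero ≢ f (suc j)
    distinct j e with f-inj zero (suc j) e
    ... | ()

  sign-swap01 : ∀ {m n} (f : Fin (ℕ.suc (ℕ.suc m)) → Fin n) →
    sign (λ j → f (transpose zero (suc zero) j)) ≡ - sign f
  sign-swap01 f = begin
    (orientation f₁ f₀ * B) * (C * E)      ≡⟨ cong (λ u → (u * B) * (C * E)) (orientation-antisym f₀ f₁) ⟩
    (- orientation f₀ f₁ * B) * (C * E)    ≡⟨ solve 4 (λ s b c e → (:- s :* b) :* (c :* e) := :- ((s :* c) :* (b :* e)))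
                                                refl (orientation f₀ f₁) B C E ⟩
    - ((orientation f₀ f₁ * C) * (B * E))  ∎
    where
    open ≡-Reasoning
    f₀ = f zero
    f₁ = f (suc zero)
    B = prodℚ (λ j → orientation f₁ (f (suc (suc j))))
    C = prodℚ (λ j → orientation f₀ (f (suc (suc j))))
    E = sign (λ j → f (suc (suc j)))

  sign-transpose : ∀ {m n} (f : Fin m → Fin n) (a b : Fin m) → a ≢ b →
    sign (λ j → f (transpose a b j)) ≡ - sign f
  sign-transpose-zero : ∀ {m n} (f : Fin (ℕ.suc m) → Fin n) (b : Fin m) →
    sign (λ j → f (transpose zero (suc b) j)) ≡ - sign f
  sign-transpose-suc : ∀ {m n} (f : Fin (ℕ.suc m) → Fin n) (a b : Fin m) → a ≢ b →
    sign (λ j → f (transpose (suc a) (suc b) j)) ≡ - sign f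

  sign-transpose f zero zero a≢b = ⊥-elim (a≢b refl)
  sign-transpose f zero (suc b) _ = sign-transpose-zero f b
  sign-transpose f (suc a) zero _ =
    trans (sign-cong (λ j → cong f (transpose-comm (suc a) zero j))) (sign-transpose-zero f a)
  sign-transpose f (suc a) (suc b) a≢b = sign-transpose-suc f a b (a≢b ∘ cong suc)

  sign-transpose-zero f zero = sign-swap01 f
  sign-transpose-zero f (suc b) = begin
    sign (λ j → f (transpose zero (suc (suc b)) j))  ≡⟨ sign-cong (λ j → cong f (transpose-conj b j)) ⟩
    sign (λ j → g₂ (transpose zero (suc zero) j))    ≡⟨ sign-swap01 g₂ ⟩
    - sign g₂                                        ≡⟨ cong -_ (sign-transpose-suc g₁ zero (suc b) (λ ())) ⟩
    - (- sign g₁)                                    ≡⟨ cong (λ x → - (- x)) (sign-swap01 f) ⟩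
    - (- (- sign f))                                 ≡⟨ cong -_ (⁻¹-involutive (sign f)) ⟩
    - sign f                                         ∎
    where
    open ≡-Reasoning
    g₁ = λ j → f (transpose zero (suc zero) j)
    g₂ = λ j → g₁ (transpose (suc zero) (suc (suc b)) j)

  sign-transpose-suc f a b a≢b = begin
    leadingSign (λ j → f (τ j)) * sign (λ j → f (τ (suc j)))
      ≡⟨ cong₂ _*_ (prodℚ-cong (λ j → cong (orientation (f zero) ∘ f) (transpose-suc a b j)))
                   (sign-cong (λ j → cong f (transpose-suc a b j))) ⟩
    prodℚ (λ j → orientation (f zero) (f (suc (transpose a b j)))) * sign (λ j → f (suc (transpose a b j)))
      ≡⟨ cong₂ _*_ (prodℚ-transpose (λ j → orientation (f zero) (f (suc j))) a b) (sign-transpose (tail f) a b a≢b) ⟩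
    leadingSign f * - sign (tail f)
      ≡⟨ neg-distribʳ-* (leadingSign f) (sign (tail f)) ⟨
    - sign f ∎
    where
    open ≡-Reasoning
    τ = transpose (suc a) (suc b)

  sumMaps : ∀ {m n} → ((Fin m → Fin n) → ℚ) → ℚ
  sumMaps {ℕ.zero} F = F (λ ())
  sumMaps {ℕ.suc m} F = sumℚ (λ a → sumMaps (λ g → F (a ∷ g)))

  Extensional : ∀ {m n} → ((Fin m → Fin n) → ℚ) → Set
  Extensional F = ∀ {f g} → (∀ j → f j ≡ g j) → F f ≡ F g

  sumMaps-cong : ∀ {m n} {F G : (Fin m → Fin n) → ℚ} → (∀ f → F f ≡ G f) → sumMaps F ≡ sumMaps G
  sumMaps-cong {ℕ.zero} F≗G = F≗G _
  sumMaps-cong {ℕ.suc m} F≗G = sumℚ-cong (λ a → sumMaps-cong (λ g → F≗G (a ∷ g)))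

  sumMaps-zero : ∀ {m n} {F : (Fin m → Fin n) → ℚ} → (∀ f → F f ≡ 0ℚ) → sumMaps F ≡ 0ℚ
  sumMaps-zero {ℕ.zero} F≡0 = F≡0 _
  sumMaps-zero {ℕ.suc m} F≡0 = sumℚ-zero (λ a → sumMaps-zero (λ g → F≡0 (a ∷ g)))

  sumMaps-*ˡ : ∀ {m n} (c : ℚ) (F : (Fin m → Fin n) → ℚ) → sumMaps (λ f → c * F f) ≡ c * sumMaps F
  sumMaps-*ˡ {ℕ.zero} c F = refl
  sumMaps-*ˡ {ℕ.suc m} c F =
    trans (sumℚ-cong (λ a → sumMaps-*ˡ c (λ g → F (a ∷ g)))) (sumℚ-*ˡ c (λ a → sumMaps (λ g → F (a ∷ g))))

  sumMaps-neg : ∀ {m n} (F : (Fin m → Fin n) → ℚ) → sumMaps (λ f → - F f) ≡ - sumMaps F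
  sumMaps-neg {ℕ.zero} F = refl
  sumMaps-neg {ℕ.suc m} F =
    trans (sumℚ-cong (λ a → sumMaps-neg (λ g → F (a ∷ g)))) (sumℚ-neg (λ a → sumMaps (λ g → F (a ∷ g))))

  sumMaps-sumℚ : ∀ {m n k} (F : Fin k → (Fin m → Fin n) → ℚ) →
    sumMaps (λ f → sumℚ (λ i → F i f)) ≡ sumℚ (λ i → sumMaps (F i))
  sumMaps-sumℚ {ℕ.zero} F = refl
  sumMaps-sumℚ {ℕ.suc m} F = trans (sumℚ-cong (λ a → sumMaps-sumℚ (λ i g → F i (a ∷ g))))
                                   (sumℚ-swap (λ a i → sumMaps (λ g → F i (a ∷ g))))

  sumMaps-nonneg : ∀ {m n} (F : (Fin m → Fin n) → ℚ) → (∀ f → 0ℚ ≤ F f) → 0ℚ ≤ sumMaps F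
  sumMaps-nonneg {ℕ.zero} F F≥0 = F≥0 _
  sumMaps-nonneg {ℕ.suc m} F F≥0 = sumℚ-nonneg _ (λ a → sumMaps-nonneg (λ g → F (a ∷ g)) (λ g → F≥0 (a ∷ g)))

  sumMaps-pos : ∀ {m n} (F : (Fin m → Fin n) → ℚ) → (∀ f → 0ℚ ≤ F f) →
    (f₀ : Fin m → Fin n) → (∀ f → (∀ j → f j ≡ f₀ j) → 0ℚ < F f) → 0ℚ < sumMaps F
  sumMaps-pos {ℕ.zero} F _ f₀ F-f₀>0 = F-f₀>0 _ (λ ())
  sumMaps-pos {ℕ.suc m} F F≥0 f₀ F-f₀>0 =
    sumℚ-pos _ (λ a → sumMaps-nonneg (λ g → F (a ∷ g)) (λ g → F≥0 (a ∷ g))) (f₀ zero)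
      (sumMaps-pos (λ g → F (f₀ zero ∷ g)) (λ g → F≥0 (f₀ zero ∷ g)) (tail f₀)
                   (λ g g≗ → F-f₀>0 (f₀ zero ∷ g) (λ { zero → refl ; (suc j) → g≗ j })))

  sumMaps-swap01 : ∀ {m n} (F : (Fin (ℕ.suc (ℕ.suc m)) → Fin n) → ℚ) → Extensional F →
    sumMaps (λ f → F (λ j → f (transpose zero (suc zero) j))) ≡ sumMaps F
  sumMaps-swap01 F F-ext =
    trans (sumℚ-cong (λ x → sumℚ-cong (λ y → sumMaps-cong (λ g → F-ext (swapped x y g)))))
          (sumℚ-swap (λ x y → sumMaps (λ g → F (y ∷ x ∷ g))))
    where
    swapped : ∀ x y g j → (x ∷ y ∷ g) (transpose zero (suc zero) j) ≡ (y ∷ x ∷ g) j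
    swapped x y g zero = refl
    swapped x y g (suc zero) = refl
    swapped x y g (suc (suc j)) = refl

  sumMaps-transpose : ∀ {m n} (F : (Fin m → Fin n) → ℚ) → Extensional F → (a b : Fin m) →
    sumMaps (λ f → F (λ j → f (transpose a b j))) ≡ sumMaps F
  sumMaps-transpose-zero : ∀ {m n} (F : (Fin (ℕ.suc m) → Fin n) → ℚ) → Extensional F → (b : Fin m) →
    sumMaps (λ f → F (λ j → f (transpose zero (suc b) j))) ≡ sumMaps F
  sumMaps-transpose-suc : ∀ {m n} (F : (Fin (ℕ.suc m) → Fin n) → ℚ) → Extensional F → (a b : Fin m) →
    sumMaps (λ f → F (λ j → f (transpose (suc a) (suc b) j))) ≡ sumMaps F

  sumMaps-transpose F F-ext zero zero = sumMaps-cong (λ f → F-ext (λ j → cong f (transpose-self j)))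
    where
    transpose-self : ∀ j → transpose zero zero j ≡ j
    transpose-self j with transpose-cases zero zero j
    ... | inj₁ refl = refl
    ... | inj₂ (inj₁ refl) = refl
    ... | inj₂ (inj₂ (j≢0 , _)) = transpose-other j≢0 j≢0
  sumMaps-transpose F F-ext zero (suc b) = sumMaps-transpose-zero F F-ext b
  sumMaps-transpose F F-ext (suc a) zero =
    trans (sumMaps-cong (λ f → F-ext (λ j → cong f (transpose-comm (suc a) zero j)))) (sumMaps-transpose-zero F F-ext a)
  sumMaps-transpose F F-ext (suc a) (suc b) = sumMaps-transpose-suc F F-ext a b

  sumMaps-transpose-zero F F-ext zero = sumMaps-swap01 F F-ext
  sumMaps-transpose-zero F F-ext (suc b) = begin
    sumMaps (λ f → F (λ j → f (transpose zero (suc (suc b)) j)))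
      ≡⟨ sumMaps-cong (λ f → F-ext (λ j → cong f (transpose-conj b j))) ⟩
    sumMaps (λ f → F (λ j → f (t01 (t₁ (t01 j)))))
      ≡⟨ sumMaps-swap01 (λ h → F (λ j → h (t₁ (t01 j)))) (λ h≗ → F-ext (λ j → h≗ (t₁ (t01 j)))) ⟩
    sumMaps (λ f → F (λ j → f (t₁ (t01 j))))
      ≡⟨ sumMaps-transpose-suc (λ h → F (λ j → h (t01 j))) (λ h≗ → F-ext (λ j → h≗ (t01 j))) zero (suc b) ⟩
    sumMaps (λ f → F (λ j → f (t01 j)))
      ≡⟨ sumMaps-swap01 F F-ext ⟩
    sumMaps F ∎
    where
    open ≡-Reasoning
    t01 = transpose zero (suc zero)
    t₁ = transpose (suc zero) (suc (suc b))

  sumMaps-transpose-suc F F-ext a b = sumℚ-cong (λ x →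
    trans (sumMaps-cong (λ g → F-ext (shifted x g)))
          (sumMaps-transpose (λ g → F (x ∷ g)) (λ g≗ → F-ext (∷-cong x g≗)) a b))
    where
    shifted : ∀ x g j → (x ∷ g) (transpose (suc a) (suc b) j) ≡ (x ∷ (λ k → g (transpose a b k))) j
    shifted x g zero = refl
    shifted x g (suc j) = cong (x ∷ g) (transpose-suc a b j)
    ∷-cong : ∀ x {g h : Fin _ → _} → (∀ j → g j ≡ h j) → ∀ j → (x ∷ g) j ≡ (x ∷ h) j
    ∷-cong x g≗h zero = refl
    ∷-cong x g≗h (suc j) = g≗h j

  leibnizTerm : ∀ {n} → Matrix n → (Fin n → Fin n) → ℚ
  leibnizTerm M f = sign f * prodℚ (λ j → M (f j) j)

  det : ∀ {n} → Matrix n → ℚ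
  det M = sumMaps (leibnizTerm M)

  leibnizTerm-ext : ∀ {n} (M : Matrix n) → Extensional (leibnizTerm M)
  leibnizTerm-ext M f≗g = cong₂ _*_ (sign-cong f≗g) (prodℚ-cong (λ j → cong (λ u → M u j) (f≗g j)))

  det-cong : ∀ {n} {M M′ : Matrix n} → (∀ i j → M i j ≡ M′ i j) → det M ≡ det M′
  det-cong M≗M′ = sumMaps-cong (λ f → cong (sign f *_) (prodℚ-cong (λ j → M≗M′ (f j) j)))

  det-equal-columns : ∀ {n} (M : Matrix n) {c k : Fin n} → c ≢ k → (∀ i → M i c ≡ M i k) → det M ≡ 0ℚ
  det-equal-columns M {c} {k} c≢k same = p≡-p⇒p≡0 (det M) (begin
    det M                                               ≡⟨ sumMaps-transpose (leibnizTerm M) (leibnizTerm-ext M) c k ⟨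
    sumMaps (λ f → leibnizTerm M (λ j → f (τ j)))       ≡⟨ sumMaps-cong swap-term ⟩
    sumMaps (λ f → - leibnizTerm M f)                   ≡⟨ sumMaps-neg (leibnizTerm M) ⟩
    - det M                                             ∎)
    where
    open ≡-Reasoning
    τ = transpose c k
    columns-swap : ∀ i j → M i (τ j) ≡ M i j
    columns-swap i j with transpose-cases c k j
    ... | inj₁ refl = trans (cong (M i) (transpose-matchˡ j k)) (sym (same i))
    ... | inj₂ (inj₁ refl) = trans (cong (M i) (transpose-matchʳ c j)) (same i)
    ... | inj₂ (inj₂ (j≢c , j≢k)) = cong (M i) (transpose-other j≢c j≢k)
    swap-term : ∀ f → leibnizTerm M (λ j → f (τ j)) ≡ - leibnizTerm M f
    swap-term f = begin
      sign (λ j → f (τ j)) * prodℚ (λ j → M (f (τ j)) j)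
        ≡⟨ cong₂ _*_ (sign-transpose f c k c≢k) (sym (prodℚ-transpose (λ j → M (f (τ j)) j) c k)) ⟩
      - sign f * prodℚ (λ j → M (f (τ (τ j))) (τ j))
        ≡⟨ cong (- sign f *_) (prodℚ-cong (λ j → trans (cong (λ u → M (f u) (τ j)) (transpose-involutive c k j))
                                                       (columns-swap (f j) j))) ⟩
      - sign f * prodℚ (λ j → M (f j) j)
        ≡⟨ neg-distribˡ-* (sign f) _ ⟨
      - leibnizTerm M f ∎

  replaceColumn : ∀ {n} → Matrix n → Fin n → (Fin n → ℚ) → Matrix n
  replaceColumn M c v i j = if does (j Fin.≟ c) then v i else M i j

  private
    cofactorTerm : ∀ {n} → Matrix n → Fin n → (Fin n → Fin n) → ℚ
    cofactorTerm M c f = prodℚ (λ j → if does (j Fin.≟ c) then 1ℚ else M (f j) j)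

  det-replaceColumn : ∀ {n} (M : Matrix n) c v →
    det (replaceColumn M c v) ≡ sumMaps (λ f → sign f * (v (f c) * cofactorTerm M c f))
  det-replaceColumn M c v = sumMaps-cong (λ f → cong (sign f *_)
    (trans (prodℚ-extract (λ j → replaceColumn M c v (f j) j) c)
           (cong₂ _*_ at-c (prodℚ-cong (λ j → off-c f j)))))
    where
    at-c : ∀ {i} → replaceColumn M c v i c ≡ v i
    at-c rewrite dec-true (c Fin.≟ c) refl = refl
    off-c : ∀ f j → (if does (j Fin.≟ c) then 1ℚ else replaceColumn M c v (f j) j)
                  ≡ (if does (j Fin.≟ c) then 1ℚ else M (f j) j)
    off-c f j with j Fin.≟ c
    ... | yes _ = refl
    ... | no _ = refl

  det-replaceColumn-combination : ∀ {n} (M : Matrix n) c (y : Fin n → ℚ) →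
    det (replaceColumn M c (λ i → sumℚ (λ k → M i k * y k)))
      ≡ sumℚ (λ k → y k * det (replaceColumn M c (λ i → M i k)))
  det-replaceColumn-combination M c y = begin
    det (replaceColumn M c (λ i → sumℚ (λ k → M i k * y k)))
      ≡⟨ det-replaceColumn M c (λ i → sumℚ (λ k → M i k * y k)) ⟩
    sumMaps (λ f → sign f * (sumℚ (λ k → M (f c) k * y k) * Q f))
      ≡⟨ sumMaps-cong (λ f → expand f) ⟩
    sumMaps (λ f → sumℚ (λ k → y k * (sign f * (M (f c) k * Q f))))
      ≡⟨ sumMaps-sumℚ (λ k f → y k * (sign f * (M (f c) k * Q f))) ⟩
    sumℚ (λ k → sumMaps (λ f → y k * (sign f * (M (f c) k * Q f))))
      ≡⟨ sumℚ-cong (λ k → trans (sumMaps-*ˡ (y k) (λ f → sign f * (M (f c) k * Q f)))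
                                (cong (y k *_) (sym (det-replaceColumn M c (λ i → M i k))))) ⟩
    sumℚ (λ k → y k * det (replaceColumn M c (λ i → M i k))) ∎
    where
    open ≡-Reasoning
    Q = cofactorTerm M c
    expand : ∀ f → sign f * (sumℚ (λ k → M (f c) k * y k) * Q f) ≡ sumℚ (λ k → y k * (sign f * (M (f c) k * Q f)))
    expand f = begin
      sign f * (sumℚ (λ k → M (f c) k * y k) * Q f)
        ≡⟨ cong (sign f *_) (*-comm (sumℚ (λ k → M (f c) k * y k)) (Q f)) ⟩
      sign f * (Q f * sumℚ (λ k → M (f c) k * y k))
        ≡⟨ cong (sign f *_) (sumℚ-*ˡ (Q f) (λ k → M (f c) k * y k)) ⟨
      sign f * sumℚ (λ k → Q f * (M (f c) k * y k))
        ≡⟨ sumℚ-*ˡ (sign f) (λ k → Q f * (M (f c) k * y k)) ⟨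
      sumℚ (λ k → sign f * (Q f * (M (f c) k * y k)))
        ≡⟨ sumℚ-cong (λ k → solve 4 (λ s q m x → s :* (q :* (m :* x)) := x :* (s :* (m :* q))) refl
                                     (sign f) (Q f) (M (f c) k) (y k)) ⟩
      sumℚ (λ k → y k * (sign f * (M (f c) k * Q f))) ∎

  det≢0⇒kernel-trivial : ∀ {n} (M : Matrix n) → det M ≢ 0ℚ → (y : Fin n → ℚ) →
    (∀ i → (M · y) i ≡ 0ℚ) → ∀ c → y c ≡ 0ℚ
  det≢0⇒kernel-trivial M detM≢0 y My≡0 c =
    [ id , (λ detM≡0 → ⊥-elim (detM≢0 detM≡0)) ]′ (p*q≡0⇒p≡0∨q≡0 (y c) (det M) yc*detM≡0)
    where
    open ≡-Reasoning
    yc*detM≡0 : y c * det M ≡ 0ℚ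
    yc*detM≡0 = begin
      y c * det M
        ≡⟨ cong (y c *_) (det-cong (λ i j → sym (replaced-by-itself i j))) ⟩
      y c * det (replaceColumn M c (λ i → M i c))
        ≡⟨ sumℚ-single (λ k → y k * det (replaceColumn M c (λ i → M i k))) c
             (λ k k≢c → trans (cong (y k *_) (det-equal-columns (replaceColumn M c (λ i → M i k)) (k≢c ∘ sym) (same-column k k≢c)))
                                             (*-zeroʳ (y k))) ⟨
      sumℚ (λ k → y k * det (replaceColumn M c (λ i → M i k)))
        ≡⟨ det-replaceColumn-combination M c y ⟨
      det (replaceColumn M c (λ i → sumℚ (λ k → M i k * y k)))
        ≡⟨ det-replaceColumn M c (λ i → sumℚ (λ k → M i k * y k)) ⟩
      sumMaps (λ f → sign f * (sumℚ (λ k → M (f c) k * y k) * cofactorTerm M c f))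
        ≡⟨ sumMaps-zero (λ f → trans (cong (λ u → sign f * (u * cofactorTerm M c f)) (My≡0 (f c)))
                                      (trans (cong (sign f *_) (*-zeroˡ (cofactorTerm M c f))) (*-zeroʳ (sign f)))) ⟩
      0ℚ ∎
      where
      replaced-by-itself : ∀ i j → replaceColumn M c (λ i → M i c) i j ≡ M i j
      replaced-by-itself i j with j Fin.≟ c
      ... | yes refl = refl
      ... | no _ = refl
      same-column : ∀ k → k ≢ c → ∀ i → replaceColumn M c (λ i → M i k) i c ≡ replaceColumn M c (λ i → M i k) i k
      same-column k k≢c i rewrite dec-true (c Fin.≟ c) refl | dec-false (k Fin.≟ c) k≢c = refl

module LinearSystems where

  open FiniteSums
  open import Data.Nat as ℕ using (ℕ; s≤s; _<_)
  import Data.Nat.Properties as ℕ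
  open import Data.Fin using (punchIn)
  import Data.Fin.Properties as Fin
  open import Data.Vec.Functional using (insertAt)
  open import Data.Vec.Functional.Properties using (insertAt-lookup; insertAt-punchIn)
  open import Data.Rational using (ℚ; 0ℚ; 1ℚ; _+_; _*_; -_; 1/_; NonZero; ≢-nonZero)
  open import Data.Rational.Properties using (_≟_; *-zeroˡ; *-zeroʳ; *-inverseʳ; *-identityʳ; +-identityˡ)
  open import Data.Rational.Solver using (module +-*-Solver)
  open +-*-Solver
  open import Relation.Nullary using (¬?)
  open import Relation.Nullary.Decidable using (decidable-stable)
  open import Function using (_∘_)

  fewer-equations⇒nonzero-solution : ∀ {a k} → a < k → (E : Fin a → Fin k → ℚ) →
    Σ[ y ∈ (Fin k → ℚ) ] (∃ λ j → y j ≢ 0ℚ) × (∀ i → (E · y) i ≡ 0ℚ)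
  fewer-equations⇒nonzero-solution {ℕ.zero} {ℕ.suc k} _ E = (λ _ → 1ℚ) , (zero , λ ()) , (λ ())
  fewer-equations⇒nonzero-solution {ℕ.suc a} {ℕ.suc k} (s≤s a<k) E with Fin.any? (λ j → ¬? (E zero j ≟ 0ℚ))
  ... | no first-row-zero = y , y≢0 , solves
    where
    rest = fewer-equations⇒nonzero-solution (ℕ.m<n⇒m<1+n a<k) (λ i → E (suc i))
    y = proj₁ rest
    y≢0 = proj₁ (proj₂ rest)
    solves : ∀ i → (E · y) i ≡ 0ℚ
    solves zero = sumℚ-zero (λ j → trans (cong (_* y j) (decidable-stable (E zero j ≟ 0ℚ) (first-row-zero ∘ (j ,_)))) (*-zeroˡ (y j)))
    solves (suc i) = proj₂ (proj₂ rest) i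
  ... | yes (p , Ep≢0) = y , (punchIn p l₀ , λ e → y′l₀≢0 (trans (sym (insertAt-punchIn y′ p yₚ l₀)) e)) , solves
    where
    instance
      _ : NonZero (E zero p)
      _ = ≢-nonZero Ep≢0
    d = 1/ (E zero p)
    -- Gaussian elimination of the pivot variable p by means of the first row
    E′ : Fin _ → Fin k → ℚ
    E′ r l = E (suc r) (punchIn p l) + - (E (suc r) p * (E zero (punchIn p l) * d))
    rec = fewer-equations⇒nonzero-solution a<k E′
    y′ = proj₁ rec
    l₀ = proj₁ (proj₁ (proj₂ rec))
    y′l₀≢0 = proj₂ (proj₁ (proj₂ rec))
    S₀ = sumℚ (λ l → E zero (punchIn p l) * y′ l)
    yₚ = - (S₀ * d)
    y = insertAt y′ p yₚ
    split : ∀ i → (E · y) i ≡ E i p * yₚ + sumℚ (λ l → E i (punchIn p l) * y′ l)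
    split i = trans (sumℚ-punchIn (λ m → E i m * y m) p)
                    (cong₂ (λ u v → E i p * u + v) (insertAt-lookup y′ p yₚ)
                           (sumℚ-cong (λ l → cong (E i (punchIn p l) *_) (insertAt-punchIn y′ p yₚ l))))
    solves : ∀ i → (E · y) i ≡ 0ℚ
    solves zero = begin
      (E · y) zero
        ≡⟨ split zero ⟩
      E zero p * yₚ + S₀
        ≡⟨ solve 3 (λ e s x → e :* (:- (s :* x)) :+ s := (:- (s :* (e :* x))) :+ s) refl (E zero p) S₀ d ⟩
      - (S₀ * (E zero p * d)) + S₀
        ≡⟨ cong (λ u → - (S₀ * u) + S₀) (*-inverseʳ (E zero p)) ⟩
      - (S₀ * 1ℚ) + S₀
        ≡⟨ solve 1 (λ s → (:- (s :* con 1ℚ)) :+ s := con 0ℚ) refl S₀ ⟩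
      0ℚ ∎
      where open ≡-Reasoning
    solves (suc r) = begin
      (E · y) (suc r)
        ≡⟨ split (suc r) ⟩
      E (suc r) p * yₚ + T
        ≡⟨ solve 4 (λ e s x t → e :* (:- (s :* x)) :+ t := t :+ (:- (e :* x)) :* s) refl (E (suc r) p) S₀ d T ⟩
      T + - (E (suc r) p * d) * S₀
        ≡⟨ eliminated ⟨
      (E′ · y′) r
        ≡⟨ proj₂ (proj₂ rec) r ⟩
      0ℚ ∎
      where
      open ≡-Reasoning
      T = sumℚ (λ l → E (suc r) (punchIn p l) * y′ l)
      eliminated : (E′ · y′) r ≡ T + - (E (suc r) p * d) * S₀
      eliminated =
        trans (sumℚ-cong (λ l → solve 5 (λ A B C x z → (A :+ (:- (B :* (C :* x)))) :* z := A :* z :+ (:- (B :* x)) :* (C :* z)) refl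
                                          (E (suc r) (punchIn p l)) (E (suc r) p) (E zero (punchIn p l)) d (y′ l)))
        (trans (sumℚ-+ (λ l → E (suc r) (punchIn p l) * y′ l) (λ l → - (E (suc r) p * d) * (E zero (punchIn p l) * y′ l)))
               (cong (T +_) (sumℚ-*ˡ (- (E (suc r) p * d)) (λ l → E zero (punchIn p l) * y′ l))))

  -- A square system with trivial kernel is solvable: a nonzero solution (z₀, z) of
  -- the homogeneous system  b z₀ + M z = 0  has z₀ ≢ 0, so w = - z / z₀ solves M w = b.
  kernel-trivial⇒solvable : ∀ {n} (M : Matrix n) → (∀ y → (∀ i → (M · y) i ≡ 0ℚ) → ∀ j → y j ≡ 0ℚ) →
    (b : Fin n → ℚ) → ∃ λ w → ∀ i → (M · w) i ≡ b i
  kernel-trivial⇒solvable {n} M kernel-trivial b = w , solves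
    where
    E : Fin n → Fin (ℕ.suc n) → ℚ
    E i zero = b i
    E i (suc j) = M i j
    sol = fewer-equations⇒nonzero-solution (ℕ.n<1+n n) E
    z₀ = proj₁ sol zero
    z = λ j → proj₁ sol (suc j)
    Mz≡-bz₀ : ∀ i → (M · z) i ≡ - (b i * z₀)
    Mz≡-bz₀ i = trans (solve 2 (λ a s → s := (a :+ s) :+ (:- a)) refl (b i * z₀) ((M · z) i))
                      (trans (cong (_+ - (b i * z₀)) (proj₂ (proj₂ sol) i)) (+-identityˡ _))
    z₀≢0 : z₀ ≢ 0ℚ
    z₀≢0 z₀≡0 with proj₁ (proj₂ sol)
    ... | zero , z₀≢0 = z₀≢0 z₀≡0
    ... | suc j , zj≢0 = zj≢0 (kernel-trivial z Mz≡0 j)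
      where
      Mz≡0 : ∀ i → (M · z) i ≡ 0ℚ
      Mz≡0 i = trans (trans (Mz≡-bz₀ i) (cong (λ u → - (b i * u)) z₀≡0)) (cong -_ (*-zeroʳ (b i)))
    instance
      _ : NonZero z₀
      _ = ≢-nonZero z₀≢0
    w : Fin n → ℚ
    w j = - (z j * 1/ z₀)
    solves : ∀ i → (M · w) i ≡ b i
    solves i = begin
      (M · w) i
        ≡⟨ sumℚ-cong (λ j → solve 3 (λ m x d → m :* (:- (x :* d)) := (:- d) :* (m :* x)) refl (M i j) (z j) (1/ z₀)) ⟩
      sumℚ (λ j → (- 1/ z₀) * (M i j * z j))
        ≡⟨ sumℚ-*ˡ (- 1/ z₀) (λ j → M i j * z j) ⟩
      (- 1/ z₀) * (M · z) i
        ≡⟨ cong ((- 1/ z₀) *_) (Mz≡-bz₀ i) ⟩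
      (- 1/ z₀) * (- (b i * z₀))
        ≡⟨ solve 3 (λ d x y → (:- d) :* (:- (x :* y)) := x :* (y :* d)) refl (1/ z₀) (b i) z₀ ⟩
      b i * (z₀ * 1/ z₀)
        ≡⟨ cong (b i *_) (*-inverseʳ z₀) ⟩
      b i * 1ℚ
        ≡⟨ *-identityʳ (b i) ⟩
      b i ∎
      where open ≡-Reasoning

module BooleanSets where

  open import Data.Nat as ℕ using (ℕ; _+_; _≤_; _<_; z≤n; s≤s)
  import Data.Nat.Properties as ℕ
  import Data.Fin.Properties as Fin
  open import Data.Vec.Functional using (tail)
  open import Algebra.Properties.CommutativeSemigroup ℕ.+-commutativeSemigroup using (interchange)
  open import Relation.Nullary.Decidable using (dec-true; dec-false)

  true-or-false : ∀ b → b ≡ true ⊎ b ≡ false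
  true-or-false true = inj₁ refl
  true-or-false false = inj₂ refl

  ∧-true : ∀ {a b} → a ∧ b ≡ true → a ≡ true × b ≡ true
  ∧-true {true} {true} _ = refl , refl

  ∨-true : ∀ {a b} → a ∨ b ≡ true → a ≡ true ⊎ b ≡ true
  ∨-true {true} _ = inj₁ refl
  ∨-true {false} b≡true = inj₂ b≡true

  not≡true⇒≡false : ∀ {a} → not a ≡ true → a ≡ false
  not≡true⇒≡false {false} _ = refl

  fromBool : Bool → ℕ
  fromBool true = 1
  fromBool false = 0

  count : ∀ {n} → (Fin n → Bool) → ℕ
  count {ℕ.zero} p = 0
  count {ℕ.suc n} p = fromBool (p zero) + count (tail p)

  infix 4 _⊆ᵇ_
  _⊆ᵇ_ : ∀ {n} → (Fin n → Bool) → (Fin n → Bool) → Set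
  p ⊆ᵇ q = ∀ i → p i ≡ true → q i ≡ true

  anyᵇ : ∀ {n} → (Fin n → Bool) → Bool
  anyᵇ {ℕ.zero} p = false
  anyᵇ {ℕ.suc n} p = p zero ∨ anyᵇ (tail p)

  singleton : ∀ {n} → Fin n → Fin n → Bool
  singleton c i = does (i Fin.≟ c)

  singleton-self : ∀ {n} (c : Fin n) → singleton c c ≡ true
  singleton-self c = dec-true (c Fin.≟ c) refl

  singleton-other : ∀ {n} {c i : Fin n} → i ≢ c → singleton c i ≡ false
  singleton-other {c = c} {i} i≢c = dec-false (i Fin.≟ c) i≢c

  singleton⇒≡ : ∀ {n} {c i : Fin n} → singleton c i ≡ true → i ≡ c
  singleton⇒≡ {c = c} {i} _ with i Fin.≟ c
  ... | yes i≡c = i≡c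

  fromBool-mono : ∀ {a b} → (a ≡ true → b ≡ true) → fromBool a ≤ fromBool b
  fromBool-mono {false} _ = z≤n
  fromBool-mono {true} a⇒b rewrite a⇒b refl = ℕ.≤-refl

  count-cong : ∀ {n} {p q : Fin n → Bool} → (∀ i → p i ≡ q i) → count p ≡ count q
  count-cong {ℕ.zero} p≗q = refl
  count-cong {ℕ.suc n} p≗q = cong₂ _+_ (cong fromBool (p≗q zero)) (count-cong (λ i → p≗q (suc i)))

  count-mono : ∀ {n} {p q : Fin n → Bool} → p ⊆ᵇ q → count p ≤ count q
  count-mono {ℕ.zero} p⊆q = z≤n
  count-mono {ℕ.suc n} p⊆q = ℕ.+-mono-≤ (fromBool-mono (p⊆q zero)) (count-mono (λ i → p⊆q (suc i)))

  count-mono-< : ∀ {n} {p q : Fin n → Bool} → p ⊆ᵇ q → (c : Fin n) → p c ≡ false → q c ≡ true →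
    count p < count q
  count-mono-< p⊆q zero pc≡false qc≡true rewrite pc≡false | qc≡true = s≤s (count-mono (λ i → p⊆q (suc i)))
  count-mono-< p⊆q (suc c) pc≡false qc≡true =
    ℕ.+-mono-≤-< (fromBool-mono (p⊆q zero)) (count-mono-< (λ i → p⊆q (suc i)) c pc≡false qc≡true)

  count-pointwise : ∀ {n} (p q r s : Fin n → Bool) →
    (∀ i → fromBool (p i) + fromBool (q i) ≡ fromBool (r i) + fromBool (s i)) →
    count p + count q ≡ count r + count s
  count-pointwise {ℕ.zero} p q r s _ = refl
  count-pointwise {ℕ.suc n} p q r s eq = begin
    (fromBool (p zero) + count (tail p)) + (fromBool (q zero) + count (tail q))
      ≡⟨ interchange (fromBool (p zero)) (count (tail p)) (fromBool (q zero)) (count (tail q)) ⟩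
    (fromBool (p zero) + fromBool (q zero)) + (count (tail p) + count (tail q))
      ≡⟨ cong₂ _+_ (eq zero) (count-pointwise (tail p) (tail q) (tail r) (tail s) (λ i → eq (suc i))) ⟩
    (fromBool (r zero) + fromBool (s zero)) + (count (tail r) + count (tail s))
      ≡⟨ interchange (fromBool (r zero)) (fromBool (s zero)) (count (tail r)) (count (tail s)) ⟩
    (fromBool (r zero) + count (tail r)) + (fromBool (s zero) + count (tail s)) ∎
    where open ≡-Reasoning

  count-empty : ∀ {n} {p : Fin n → Bool} → (∀ i → p i ≡ false) → count p ≡ 0
  count-empty {ℕ.zero} _ = refl
  count-empty {ℕ.suc n} p≡false rewrite p≡false zero = count-empty (λ i → p≡false (suc i))

  count≤n : ∀ {n} (p : Fin n → Bool) → count p ≤ n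
  count≤n {ℕ.zero} p = z≤n
  count≤n {ℕ.suc n} p with p zero
  ... | true = s≤s (count≤n (tail p))
  ... | false = ℕ.m≤n⇒m≤1+n (count≤n (tail p))

  count-singleton : ∀ {n} (c : Fin n) → count (singleton c) ≡ 1
  count-singleton {ℕ.suc n} zero = cong ℕ.suc (count-empty {n} (λ _ → refl))
  count-singleton (suc c) = count-singleton c

  count-∨-disjoint : ∀ {n} (p q : Fin n → Bool) → (∀ i → p i ≡ true → q i ≡ false) →
    count (λ i → p i ∨ q i) ≡ count p + count q
  count-∨-disjoint {n} p q disjoint = begin
    count (λ i → p i ∨ q i)                          ≡⟨ ℕ.+-identityʳ _ ⟨
    count (λ i → p i ∨ q i) + 0                      ≡⟨ cong (count (λ i → p i ∨ q i) +_) (count-empty {n} (λ _ → refl)) ⟨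
    count (λ i → p i ∨ q i) + count {n} (λ _ → false) ≡⟨ count-pointwise _ _ p q (λ i → pointwise (p i) (q i) (disjoint i)) ⟩
    count p + count q                                ∎
    where
    open ≡-Reasoning
    pointwise : ∀ a b → (a ≡ true → b ≡ false) → fromBool (a ∨ b) + 0 ≡ fromBool a + fromBool b
    pointwise true true a⇒¬b with a⇒¬b refl
    ... | ()
    pointwise true false _ = refl
    pointwise false b _ = ℕ.+-identityʳ (fromBool b)

  count-∨-≤ : ∀ {n} (p q : Fin n → Bool) → count (λ i → p i ∨ q i) ≤ count p + count q
  count-∨-≤ p q = begin
    count (λ i → p i ∨ q i)                            ≤⟨ ℕ.m≤m+n _ _ ⟩
    count (λ i → p i ∨ q i) + count (λ i → p i ∧ q i)  ≡⟨ count-pointwise _ _ p q (λ i → pointwise (p i) (q i)) ⟩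
    count p + count q                                  ∎
    where
    open ℕ.≤-Reasoning
    pointwise : ∀ a b → fromBool (a ∨ b) + fromBool (a ∧ b) ≡ fromBool a + fromBool b
    pointwise true true = refl
    pointwise true false = refl
    pointwise false true = refl
    pointwise false false = refl

  count-split : ∀ {n} (p q : Fin n → Bool) → q ⊆ᵇ p → count p ≡ count (λ i → p i ∧ not (q i)) + count q
  count-split p q q⊆p = trans (count-cong (λ i → pointwise (p i) (q i) (q⊆p i)))
                              (count-∨-disjoint (λ i → p i ∧ not (q i)) q (λ i → disjoint (p i) (q i)))
    where
    pointwise : ∀ a b → (b ≡ true → a ≡ true) → a ≡ (a ∧ not b) ∨ b
    pointwise true true _ = refl
    pointwise true false _ = refl
    pointwise false true b⇒a = b⇒a refl
    pointwise false false _ = refl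
    disjoint : ∀ a b → a ∧ not b ≡ true → b ≡ false
    disjoint true false _ = refl

  count>0⇒nonempty : ∀ {n} (p : Fin n → Bool) → 0 < count p → ∃ λ i → p i ≡ true
  count>0⇒nonempty {ℕ.suc n} p 0<count with p zero in p₀
  ... | true = zero , p₀
  ... | false = let (i , pi) = count>0⇒nonempty (tail p) 0<count in suc i , pi

  anyᵇ-intro : ∀ {n} (p : Fin n → Bool) (i : Fin n) → p i ≡ true → anyᵇ p ≡ true
  anyᵇ-intro p zero pi rewrite pi = refl
  anyᵇ-intro p (suc i) pi with p zero
  ... | true = refl
  ... | false = anyᵇ-intro (tail p) i pi

  anyᵇ-elim : ∀ {n} (p : Fin n → Bool) → anyᵇ p ≡ true → ∃ λ i → p i ≡ true
  anyᵇ-elim {ℕ.suc n} p any with p zero in p₀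
  ... | true = zero , p₀
  ... | false = let (i , pi) = anyᵇ-elim (tail p) any in suc i , pi

  anyᵇ-false : ∀ {n} (p : Fin n → Bool) → anyᵇ p ≡ false → ∀ i → p i ≡ false
  anyᵇ-false p none i with p i in pi
  ... | false = refl
  ... | true with () ← trans (sym (anyᵇ-intro p i pi)) none

  anyᵇ-cong : ∀ {n} {p q : Fin n → Bool} → (∀ i → p i ≡ q i) → anyᵇ p ≡ anyᵇ q
  anyᵇ-cong {ℕ.zero} p≗q = refl
  anyᵇ-cong {ℕ.suc n} p≗q = cong₂ _∨_ (p≗q zero) (anyᵇ-cong (λ i → p≗q (suc i)))

  count≡0⇒empty : ∀ {n} (p : Fin n → Bool) → count p ≡ 0 → ∀ i → p i ≡ false
  count≡0⇒empty p count≡0 i with p i in pi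
  ... | false = refl
  ... | true = ⊥-elim (ℕ.1+n≰n (begin
    1                    ≡⟨ count-singleton i ⟨
    count (singleton i)  ≤⟨ count-mono {p = singleton i} {q = p} singleton⊆p ⟩
    count p              ≡⟨ count≡0 ⟩
    0                    ∎))
    where
    open ℕ.≤-Reasoning
    singleton⊆p : singleton i ⊆ᵇ p
    singleton⊆p j j≡i = subst (λ k → p k ≡ true) (sym (singleton⇒≡ {c = i} {j} j≡i)) pi

module HallsTheorem where

  open BooleanSets
  open import Data.Nat as ℕ using (ℕ; _+_; _≤_; _<_; z≤n)
  import Data.Nat.Properties as ℕ
  import Data.Fin.Properties as Fin
  open import Data.Bool using () renaming (_≟_ to _≟ᵇ_)
  open import Data.Bool.Properties using (∧-zeroʳ; ∨-zeroʳ; ∨-identityʳ; ¬-not)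
  open import Function using (_∘_)
  open import Data.Fin.Subset.Properties using (anySubset?)
  open import Data.Vec using (lookup; tabulate)
  open import Data.Vec.Properties using (lookup∘tabulate)
  open import Relation.Nullary.Decidable using (_×-dec_; _→-dec_; map′)

  module _ {n : ℕ} where

    neighbours : (Fin n → Fin n → Bool) → (Fin n → Bool) → Fin n → Bool
    neighbours R W y = anyᵇ (λ x → W x ∧ R x y)

    HallCondition : (Fin n → Bool) → (Fin n → Fin n → Bool) → Set
    HallCondition X R = ∀ W → W ⊆ᵇ X → count W ≤ count (neighbours R W)

    InjectiveOn : (Fin n → Bool) → (Fin n → Fin n) → Set
    InjectiveOn X φ = ∀ {x x′} → X x ≡ true → X x′ ≡ true → φ x ≡ φ x′ → x ≡ x′

    record Matching (X : Fin n → Bool) (R : Fin n → Fin n → Bool) : Set where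
      field
        partner   : Fin n → Fin n
        related   : ∀ x → X x ≡ true → R x (partner x) ≡ true
        injective : InjectiveOn X partner

    neighbours-intro : ∀ R W {x y} → W x ≡ true → R x y ≡ true → neighbours R W y ≡ true
    neighbours-intro R W {x} {y} Wx Rxy = anyᵇ-intro (λ x → W x ∧ R x y) x (cong₂ _∧_ Wx Rxy)

    neighbours-elim : ∀ R W {y} → neighbours R W y ≡ true → ∃ λ x → W x ≡ true × R x y ≡ true
    neighbours-elim R W {y} Ny = let (x , WRxy) = anyᵇ-elim (λ x → W x ∧ R x y) Ny in x , ∧-true WRxy

    neighbours-cong : ∀ R {W W′} → (∀ i → W i ≡ W′ i) → ∀ y → neighbours R W y ≡ neighbours R W′ y
    neighbours-cong R W≗W′ y = anyᵇ-cong (λ x → cong (_∧ R x y) (W≗W′ x))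

    emptyMatching : ∀ {X R} → (∀ x → X x ≡ false) → Matching X R
    emptyMatching X≡false = record
      { partner = λ x → x
      ; related = λ x Xx → ⊥-elim (∉X x Xx)
      ; injective = λ {x} Xx _ _ → ⊥-elim (∉X x Xx)
      }
      where
      ∉X : ∀ x → _ ≡ true → ⊥
      ∉X x Xx with () ← trans (sym Xx) (X≡false x)

    Critical : (Fin n → Bool) → (Fin n → Fin n → Bool) → (Fin n → Bool) → Set
    Critical X R W = W ⊆ᵇ X × (∃ λ i → W i ≡ true) × (∃ λ i → X i ≡ true × W i ≡ false)
                   × count (neighbours R W) ≤ count W

    critical-cong : ∀ {X R W W′} → (∀ i → W i ≡ W′ i) → Critical X R W → Critical X R W′
    critical-cong {R = R} W≗W′ (W⊆X , (i₁ , Wi₁) , (i₂ , Xi₂ , Wi₂) , tight) =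
      (λ i W′i → W⊆X i (trans (W≗W′ i) W′i)) ,
      (i₁ , trans (sym (W≗W′ i₁)) Wi₁) ,
      (i₂ , Xi₂ , trans (sym (W≗W′ i₂)) Wi₂) ,
      subst₂ _≤_ (count-cong (neighbours-cong R W≗W′)) (count-cong W≗W′) tight

    critical? : ∀ X R → Dec (∃ λ W → Critical X R W)
    critical? X R = map′ (λ (S , crit) → lookup S , crit)
                         (λ (W , crit) → tabulate W , critical-cong (λ i → sym (lookup∘tabulate W i)) crit)
                         (anySubset? (λ S → critical₁? (lookup S)))
      where
      critical₁? : ∀ W → Dec (Critical X R W)
      critical₁? W = Fin.all? (λ i → (W i ≟ᵇ true) →-dec (X i ≟ᵇ true))
                ×-dec Fin.any? (λ i → W i ≟ᵇ true)
                ×-dec Fin.any? (λ i → (X i ≟ᵇ true) ×-dec (W i ≟ᵇ false))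
                ×-dec (count (neighbours R W) ℕ.≤? count W)

    HallForSmaller : (Fin n → Bool) → Set
    HallForSmaller X = ∀ X′ R′ → count X′ < count X → HallCondition X′ R′ → Matching X′ R′

    -- Match W inside its neighbourhood and X ∖ W outside it; both parts inherit
    -- Hall's condition because W is critical.
    matching-critical : ∀ {X R W} → HallForSmaller X → HallCondition X R → Critical X R W → Matching X R
    matching-critical {X} {R} {W} ih hall (W⊆X , (i₁ , Wi₁) , (i₂ , Xi₂ , Wi₂) , tight) = record
      { partner = φ
      ; related = related
      ; injective = injective
      }
      where
      NW = neighbours R W
      X₂ : Fin n → Bool
      X₂ x = X x ∧ not (W x)
      R₂ : Fin n → Fin n → Bool
      R₂ x y = R x y ∧ not (NW y)

      hall₂ : HallCondition X₂ R₂
      hall₂ Z Z⊆X₂ = ℕ.+-cancelʳ-≤ (count W) (count Z) (count (neighbours R₂ Z)) (begin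
        count Z + count W                                  ≡⟨ count-∨-disjoint Z W Z∩W≡∅ ⟨
        count ZW                                           ≤⟨ hall ZW ZW⊆X ⟩
        count (neighbours R ZW)                            ≤⟨ count-mono N-ZW⊆ ⟩
        count (λ y → neighbours R₂ Z y ∨ NW y)             ≤⟨ count-∨-≤ (neighbours R₂ Z) NW ⟩
        count (neighbours R₂ Z) + count NW                 ≤⟨ ℕ.+-monoʳ-≤ (count (neighbours R₂ Z)) tight ⟩
        count (neighbours R₂ Z) + count W                  ∎)
        where
        open ℕ.≤-Reasoning
        ZW : Fin n → Bool
        ZW x = Z x ∨ W x
        Z∩W≡∅ : ∀ x → Z x ≡ true → W x ≡ false
        Z∩W≡∅ x Zx = not≡true⇒≡false (proj₂ (∧-true (Z⊆X₂ x Zx)))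
        ZW⊆X : ZW ⊆ᵇ X
        ZW⊆X x ZWx with Z x in Zx
        ... | true = proj₁ (∧-true (Z⊆X₂ x Zx))
        ... | false = W⊆X x ZWx
        N-ZW⊆ : neighbours R ZW ⊆ᵇ (λ y → neighbours R₂ Z y ∨ NW y)
        N-ZW⊆ y NZWy with NW y ≟ᵇ true
        ... | yes NWy = trans (cong (neighbours R₂ Z y ∨_) NWy) (∨-zeroʳ _)
        ... | no ¬NWy with neighbours-elim R ZW NZWy
        ...   | x , ZWx , Rxy with Z x in Zx
        ...     | true = trans (cong (neighbours R₂ Z y ∨_) NWy≡false)
                               (trans (∨-identityʳ _) (neighbours-intro R₂ Z Zx (cong₂ _∧_ Rxy (cong not NWy≡false))))
          where NWy≡false = ¬-not ¬NWy
        ...     | false = ⊥-elim (¬NWy (neighbours-intro R W ZWx Rxy))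

      m₁ : Matching W R
      m₁ = ih W R (count-mono-< W⊆X i₂ Wi₂ Xi₂) (λ Z Z⊆W → hall Z (λ i → W⊆X i ∘ Z⊆W i))
      m₂ : Matching X₂ R₂
      m₂ = ih X₂ R₂ (count-mono-< (λ i → proj₁ ∘ ∧-true) i₁ X₂i₁≡false (W⊆X i₁ Wi₁)) hall₂
        where
        X₂i₁≡false : X₂ i₁ ≡ false
        X₂i₁≡false = trans (cong (λ b → X i₁ ∧ not b) Wi₁) (∧-zeroʳ (X i₁))
      open Matching m₁ renaming (partner to φ₁; related to related₁; injective to injective₁)
      open Matching m₂ renaming (partner to φ₂; related to related₂; injective to injective₂)

      φ : Fin n → Fin n
      φ x = if W x then φ₁ x else φ₂ x

      X₂-intro : ∀ {x} → X x ≡ true → W x ≡ false → X₂ x ≡ true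
      X₂-intro Xx Wx = cong₂ _∧_ Xx (cong not Wx)

      φ₁-in : ∀ {x} → W x ≡ true → NW (φ₁ x) ≡ true
      φ₁-in {x} Wx = neighbours-intro R W Wx (related₁ x Wx)

      φ₂-avoids : ∀ {x} → X x ≡ true → W x ≡ false → NW (φ₂ x) ≡ false
      φ₂-avoids {x} Xx Wx = not≡true⇒≡false (proj₂ (∧-true (related₂ x (X₂-intro Xx Wx))))

      related : ∀ x → X x ≡ true → R x (φ x) ≡ true
      related x Xx with W x in Wx
      ... | true = related₁ x Wx
      ... | false = proj₁ (∧-true (related₂ x (X₂-intro Xx Wx)))

      injective : InjectiveOn X φ
      injective {x} {x′} Xx Xx′ φx≡φx′ with W x in Wx | W x′ in Wx′
      ... | true | true = injective₁ Wx Wx′ φx≡φx′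
      ... | false | false = injective₂ (X₂-intro Xx Wx) (X₂-intro Xx′ Wx′) φx≡φx′
      ... | true | false with () ← trans (sym (φ₁-in Wx)) (trans (cong NW φx≡φx′) (φ₂-avoids Xx′ Wx′))
      ... | false | true with () ← trans (sym (φ₁-in Wx′)) (trans (cong NW (sym φx≡φx′)) (φ₂-avoids Xx Wx))

    -- Without critical sets every nonempty Z ⊆ X has more neighbours than elements,
    -- so Hall's condition survives fixing one edge x₀ y₀ and deleting both ends.
    matching-surplus : ∀ {X R x₀} → HallForSmaller X → HallCondition X R → ¬ (∃ λ W → Critical X R W) →
      X x₀ ≡ true → Matching X R
    matching-surplus {X} {R} {x₀} ih hall no-critical Xx₀ = record
      { partner = φ
      ; related = related
      ; injective = injective
      }
      where
      y₀-neighbour : ∃ λ y → neighbours R (singleton x₀) y ≡ true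
      y₀-neighbour = count>0⇒nonempty (neighbours R (singleton x₀))
        (subst (_≤ count (neighbours R (singleton x₀))) (count-singleton x₀)
               (hall (singleton x₀) (λ x x≡x₀ → subst (λ z → X z ≡ true) (sym (singleton⇒≡ x≡x₀)) Xx₀)))
      y₀ = proj₁ y₀-neighbour
      Rx₀y₀ : R x₀ y₀ ≡ true
      Rx₀y₀ with neighbours-elim R (singleton x₀) (proj₂ y₀-neighbour)
      ... | x , x≡x₀ , Rxy₀ rewrite singleton⇒≡ {c = x₀} {x} x≡x₀ = Rxy₀

      X′ : Fin n → Bool
      X′ x = X x ∧ not (singleton x₀ x)
      R′ : Fin n → Fin n → Bool
      R′ x y = R x y ∧ not (singleton y₀ y)
      X′x₀≡false : X′ x₀ ≡ false
      X′x₀≡false = trans (cong (λ b → X x₀ ∧ not b) (singleton-self x₀)) (∧-zeroʳ (X x₀))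

      hall′ : HallCondition X′ R′
      hall′ Z Z⊆X′ with anyᵇ Z in anyZ
      ... | false = subst (_≤ count (neighbours R′ Z)) (sym (count-empty (anyᵇ-false Z anyZ))) z≤n
      ... | true = ℕ.≤-pred (begin
        ℕ.suc (count Z)                              ≤⟨ ℕ.≰⇒> Z-not-critical ⟩
        count (neighbours R Z)                       ≤⟨ count-mono N-Z⊆ ⟩
        count (λ y → neighbours R′ Z y ∨ singleton y₀ y) ≤⟨ count-∨-≤ (neighbours R′ Z) (singleton y₀) ⟩
        count (neighbours R′ Z) + count (singleton y₀) ≡⟨ cong (count (neighbours R′ Z) +_) (count-singleton y₀) ⟩
        count (neighbours R′ Z) + 1                  ≡⟨ ℕ.+-comm (count (neighbours R′ Z)) 1 ⟩
        ℕ.suc (count (neighbours R′ Z))              ∎)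
        where
        open ℕ.≤-Reasoning
        Z⊆X : Z ⊆ᵇ X
        Z⊆X x Zx = proj₁ (∧-true (Z⊆X′ x Zx))
        Zx₀≡false : Z x₀ ≡ false
        Zx₀≡false with Z x₀ in Zx₀
        ... | false = refl
        ... | true with () ← trans (sym (Z⊆X′ x₀ Zx₀)) X′x₀≡false
        Z-not-critical : ¬ (count (neighbours R Z) ≤ count Z)
        Z-not-critical tight = no-critical (Z , Z⊆X , anyᵇ-elim Z anyZ , (x₀ , Xx₀ , Zx₀≡false) , tight)
        N-Z⊆ : neighbours R Z ⊆ᵇ (λ y → neighbours R′ Z y ∨ singleton y₀ y)
        N-Z⊆ y NZy with y₀ Fin.≟ y
        ... | yes refl = trans (cong (neighbours R′ Z y ∨_) (singleton-self y)) (∨-zeroʳ _)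
        ... | no y₀≢y with neighbours-elim R Z NZy
        ...   | x , Zx , Rxy = trans (cong (neighbours R′ Z y ∨_) y∉y₀)
                                     (trans (∨-identityʳ _) (neighbours-intro R′ Z Zx (cong₂ _∧_ Rxy (cong not y∉y₀))))
          where y∉y₀ = singleton-other (y₀≢y ∘ sym)

      m′ : Matching X′ R′
      m′ = ih X′ R′ (count-mono-< (λ i → proj₁ ∘ ∧-true) x₀ X′x₀≡false Xx₀) hall′
      open Matching m′ renaming (partner to φ′; related to related′; injective to injective′)

      φ : Fin n → Fin n
      φ x = if singleton x₀ x then y₀ else φ′ x

      X′-intro : ∀ {x} → X x ≡ true → x ≢ x₀ → X′ x ≡ true
      X′-intro Xx x≢x₀ = cong₂ _∧_ Xx (cong not (singleton-other x≢x₀))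

      φ′-avoids : ∀ {x} → X x ≡ true → x ≢ x₀ → φ′ x ≢ y₀
      φ′-avoids {x} Xx x≢x₀ φ′x≡y₀ with () ←
        trans (sym (proj₂ (∧-true (related′ x (X′-intro Xx x≢x₀)))))
              (cong not (trans (cong (singleton y₀) φ′x≡y₀) (singleton-self y₀)))

      related : ∀ x → X x ≡ true → R x (φ x) ≡ true
      related x Xx with x Fin.≟ x₀
      ... | yes refl = Rx₀y₀
      ... | no x≢x₀ = proj₁ (∧-true (related′ x (X′-intro Xx x≢x₀)))

      injective : InjectiveOn X φ
      injective {x} {x′} Xx Xx′ φx≡φx′ with x Fin.≟ x₀ | x′ Fin.≟ x₀
      ... | yes x≡x₀ | yes x′≡x₀ = trans x≡x₀ (sym x′≡x₀)
      ... | yes _ | no x′≢x₀ = ⊥-elim (φ′-avoids Xx′ x′≢x₀ (sym φx≡φx′))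
      ... | no x≢x₀ | yes _ = ⊥-elim (φ′-avoids Xx x≢x₀ φx≡φx′)
      ... | no x≢x₀ | no x′≢x₀ = injective′ (X′-intro Xx x≢x₀) (X′-intro Xx′ x′≢x₀) φx≡φx′

    hall-≤ : ∀ k X R → count X ≤ k → HallCondition X R → Matching X R
    hall-≤ ℕ.zero X R X≤0 _ = emptyMatching (count≡0⇒empty X (ℕ.n≤0⇒n≡0 X≤0))
    hall-≤ (ℕ.suc k) X R X≤1+k hall with anyᵇ X in anyX | critical? X R
    ... | false | _ = emptyMatching (anyᵇ-false X anyX)
    ... | true | yes (W , critical) = matching-critical ih hall critical
      where ih = λ X′ R′ X′<X → hall-≤ k X′ R′ (ℕ.≤-pred (ℕ.<-≤-trans X′<X X≤1+k))
    ... | true | no no-critical = matching-surplus ih hall no-critical (proj₂ (anyᵇ-elim X anyX))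
      where ih = λ X′ R′ X′<X → hall-≤ k X′ R′ (ℕ.≤-pred (ℕ.<-≤-trans X′<X X≤1+k))

    hall : ∀ X R → HallCondition X R → Matching X R
    hall X R = hall-≤ (count X) X R ℕ.≤-refl

module GraphBasics where

  open import Data.Nat as ℕ using (ℕ)
  open import Data.Nat.Divisibility using (_∣_)
  open import Data.Fin using (inject₁; fromℕ)
  open import Data.List using (List; []; _∷_; length; lookup)
  open import Data.List.Membership.Propositional using (_∈_)
  open import Data.List.Membership.Propositional.Properties using (∈-lookup)
  open import Data.List.Relation.Unary.All as All using (All)
  open import Data.List.Relation.Unary.Linked using (Linked; _∷_)
  open import Data.List.Relation.Unary.Unique.Propositional using (Unique; _∷_)
  open import Data.Rational using (ℚ; 1ℚ; _*_)
  import Data.Rational.Properties as ℚ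

  module _ {n} (G : Graph n) where

    Adj-sym : ∀ {i j} → Adj G i j → Adj G j i
    Adj-sym {i} {j} i~j = trans (sym (Graph.sym G i j)) i~j

    adjMatrix-adj : ∀ {i j} → Adj G i j → adjMatrix G i j ≡ 1ℚ
    adjMatrix-adj i~j rewrite i~j = refl

    adjMatrix≡1⇒Adj : ∀ i j → adjMatrix G i j ≡ 1ℚ → Adj G i j
    adjMatrix≡1⇒Adj i j a≡1 with adj G i j
    ... | true = refl

    adjMatrix-*-cong : ∀ {i j} {x y : Fin n → ℚ} → (Adj G i j → x j ≡ y j) → adjMatrix G i j * x j ≡ adjMatrix G i j * y j
    adjMatrix-*-cong {i} {j} {x} {y} x≡y with adj G i j
    ... | true = cong (1ℚ *_) (x≡y refl)
    ... | false = trans (ℚ.*-zeroˡ (x j)) (sym (ℚ.*-zeroˡ (y j)))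

    lastOf : Fin n → List (Fin n) → Fin n
    lastOf v [] = v
    lastOf v (w ∷ ws) = lastOf w ws

    closed-walk-length : C4kFree G → ∀ v ws → Unique (v ∷ ws) → Linked (Adj G) (v ∷ ws) →
      Adj G (lastOf v ws) v → ¬ (4 ∣ ℕ.suc (length ws))
    closed-walk-length c4k-free v ws distinct walk closing 4∣len =
      c4k-free (length ws) (lookup (v ∷ ws)) 4∣len
        ((λ {i} {j} → lookup-injective (v ∷ ws) distinct i j) , steps v ws walk , subst (λ z → Adj G z v) (sym (lookup-last v ws)) closing)
      where
      lookup-injective : ∀ xs → Unique xs → ∀ i j → lookup xs i ≡ lookup xs j → i ≡ j
      lookup-injective (x ∷ xs) _ zero zero _ = refl
      lookup-injective (x ∷ xs) (x≢xs ∷ _) zero (suc j) e = ⊥-elim (All.lookup x≢xs (∈-lookup j) e)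
      lookup-injective (x ∷ xs) (x≢xs ∷ _) (suc i) zero e = ⊥-elim (All.lookup x≢xs (∈-lookup i) (sym e))
      lookup-injective (x ∷ xs) (_ ∷ distinct) (suc i) (suc j) e = cong suc (lookup-injective xs distinct i j e)
      steps : ∀ x xs → Linked (Adj G) (x ∷ xs) →
        ∀ (i : Fin (length xs)) → Adj G (lookup (x ∷ xs) (inject₁ i)) (lookup (x ∷ xs) (suc i))
      steps x (y ∷ ys) (x~y ∷ walk) zero = x~y
      steps x (y ∷ ys) (x~y ∷ walk) (suc i) = steps y ys walk i
      lookup-last : ∀ x xs → lookup (x ∷ xs) (fromℕ (length xs)) ≡ lastOf x xs
      lookup-last x [] = refl
      lookup-last x (y ∷ ys) = lookup-last y ys

  record PerfectMatching {n} (G : Graph n) (X Y : Fin n → Bool) : Set where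
    field
      to       : Fin n → Fin n
      from     : Fin n → Fin n
      to∈      : ∀ {x} → X x ≡ true → Y (to x) ≡ true
      from∈    : ∀ {y} → Y y ≡ true → X (from y) ≡ true
      from-to  : ∀ {x} → X x ≡ true → from (to x) ≡ x
      to-from  : ∀ {y} → Y y ≡ true → to (from y) ≡ y
      disjoint : ∀ {i} → X i ≡ true → Y i ≡ false
      adjacent : ∀ {x} → X x ≡ true → Adj G (to x) x

  flip : ∀ {n} {G : Graph n} {X Y} → PerfectMatching G X Y → PerfectMatching G Y X
  flip {G = G} {X} {Y} m = record
    { to = from ; from = to ; to∈ = from∈ ; from∈ = to∈ ; from-to = to-from ; to-from = from-to
    ; disjoint = disjoint′
    ; adjacent = λ {y} Yy → subst (Adj G (from y)) (to-from Yy) (Adj-sym G (adjacent (from∈ Yy)))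
    }
    where
    open PerfectMatching m
    disjoint′ : ∀ {i} → Y i ≡ true → X i ≡ false
    disjoint′ {i} Yi with X i in Xi
    ... | false = refl
    ... | true with () ← trans (sym Yi) (disjoint Xi)

module MatchedMinors where

  open FiniteSums
  open Determinants
  open Transpositions
  open LinearSystems
  open BooleanSets
  open GraphBasics
  open import Data.Nat as ℕ using (ℕ; _≤_; _<_)
  import Data.Nat.Properties as ℕ
  open import Data.Nat.Divisibility using (_∣_; divides; ∣m∣n⇒∣m+n)
  open import Data.Fin using (punchOut)
  import Data.Fin.Properties as Fin
  open import Data.Rational using (ℚ; 0ℚ; 1ℚ; _+_; _*_; -_) renaming (_≤_ to _≤ℚ_; _<_ to _<ℚ_)
  import Data.Rational.Properties as ℚ
  open import Data.Rational.Solver using (module +-*-Solver)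
  open +-*-Solver
  open import Function using (_∘_)
  open import Relation.Nullary.Decidable using (dec-true; dec-false; decidable-stable)
  open import Relation.Nullary using (¬?)
  open import Data.List using (List; []; _∷_; length)
  open import Data.List.Membership.Propositional using (_∈_; _∉_)
  open import Data.List.Relation.Unary.Any using (here; there)
  open import Data.List.Relation.Unary.All using ([])
  open import Data.List.Relation.Unary.All.Properties using (¬Any⇒All¬)
  open import Data.List.Relation.Unary.Linked using (Linked; [-]; _∷_)
  open import Data.List.Relation.Unary.Unique.Propositional using (Unique; []; _∷_)
  open import Algebra.Properties.Group ℚ.+-0-group using (⁻¹-involutive)

  alternating : ℕ → ℚ
  alternating ℕ.zero = 1ℚ
  alternating (ℕ.suc t) = - alternating t

  alternating-even : ∀ t → ¬ (4 ∣ 2 ℕ.+ (t ℕ.+ t)) → alternating t ≡ 1ℚ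
  alternating-even ℕ.zero _ = refl
  alternating-even (ℕ.suc ℕ.zero) 4∤4 = ⊥-elim (4∤4 (divides 1 refl))
  alternating-even (ℕ.suc (ℕ.suc t)) 4∤len = trans (⁻¹-involutive (alternating t)) (alternating-even t 4∤shorter)
    where
    len≡4+shorter : 2 ℕ.+ (ℕ.suc (ℕ.suc t) ℕ.+ ℕ.suc (ℕ.suc t)) ≡ 4 ℕ.+ (2 ℕ.+ (t ℕ.+ t))
    len≡4+shorter = cong (4 ℕ.+_) (trans (ℕ.+-suc t (ℕ.suc t)) (cong ℕ.suc (ℕ.+-suc t t)))
    4∤shorter : ¬ (4 ∣ 2 ℕ.+ (t ℕ.+ t))
    4∤shorter 4∣shorter = 4∤len (subst (4 ∣_) (sym len≡4+shorter) (∣m∣n⇒∣m+n (divides 1 refl) 4∣shorter))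

  injective⇒surjective : ∀ {n} (f : Fin n → Fin n) → (∀ a b → f a ≡ f b → a ≡ b) → ∀ v → ∃ λ c → f c ≡ v
  injective⇒surjective {ℕ.suc m} f f-inj v with Fin.any? (λ c → f c Fin.≟ v)
  ... | yes hit = hit
  ... | no miss = ⊥-elim (ℕ.1+n≰n (Fin.injective⇒≤ g-injective))
    where
    v∉image : ∀ c → v ≢ f c
    v∉image c v≡fc = miss (c , sym v≡fc)
    g : Fin (ℕ.suc m) → Fin m
    g c = punchOut (v∉image c)
    g-injective : ∀ {a b} → g a ≡ g b → a ≡ b
    g-injective {a} {b} ga≡gb = f-inj a b (Fin.punchOut-injective (v∉image a) (v∉image b) ga≡gb)

  module _ {n} (G : Graph n) (c4k-free : C4kFree G) {X Y : Fin n → Bool} (M : PerfectMatching G X Y) where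

    open PerfectMatching M renaming (to to φ; from to ψ)
    open import Data.List.Membership.DecPropositional (Fin._≟_ {n}) using (_∈?_)

    data Side (j : Fin n) : Set where
      inX : X j ≡ true → Side j
      inY : X j ≡ false → Y j ≡ true → Side j
      outside : X j ≡ false → Y j ≡ false → Side j

    side : ∀ j → Side j
    side j with X j in Xj | Y j in Yj
    ... | true | _ = inX Xj
    ... | false | true = inY Xj Yj
    ... | false | false = outside Xj Yj

    P : Fin n → Fin n
    P j = if X j then φ j else if Y j then ψ j else j

    P-inX : ∀ {j} → X j ≡ true → P j ≡ φ j
    P-inX Xj rewrite Xj = refl

    P-inY : ∀ {j} → X j ≡ false → Y j ≡ true → P j ≡ ψ j
    P-inY Xj Yj rewrite Xj | Yj = refl

    P-outside : ∀ {j} → X j ≡ false → Y j ≡ false → P j ≡ j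
    P-outside Xj Yj rewrite Xj | Yj = refl

    Y-P-inX : ∀ {j} → X j ≡ true → Y (P j) ≡ true
    Y-P-inX Xj = trans (cong Y (P-inX Xj)) (to∈ Xj)

    Y-P-notX : ∀ {j} → X j ≡ false → Y (P j) ≡ false
    Y-P-notX {j} Xj with side j
    ... | inX Xj′ with () ← trans (sym Xj′) Xj
    ... | inY _ Yj = trans (cong Y (P-inY Xj Yj)) (disjoint (from∈ Yj))
    ... | outside _ Yj = trans (cong Y (P-outside Xj Yj)) Yj

    Y⇒¬X : ∀ {i} → Y i ≡ true → X i ≡ false
    Y⇒¬X = PerfectMatching.disjoint (flip M)

    P-involutive : ∀ j → P (P j) ≡ j
    P-involutive j with side j
    ... | inX Xj = trans (cong P (P-inX Xj)) (trans (P-inY (Y⇒¬X (to∈ Xj)) (to∈ Xj)) (from-to Xj))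
    ... | inY Xj Yj = trans (cong P (P-inY Xj Yj)) (trans (P-inX (from∈ Yj)) (to-from Yj))
    ... | outside Xj Yj = trans (cong P (P-outside Xj Yj)) (P-outside Xj Yj)

    P-injective : ∀ a b → P a ≡ P b → a ≡ b
    P-injective a b Pa≡Pb = trans (sym (P-involutive a)) (trans (cong P Pa≡Pb) (P-involutive b))

    -- N agrees with the adjacency matrix on the block Y × X, vanishes on the other
    -- rows of the X-columns, and is the permutation matrix of P on all other columns.
    N : Matrix n
    N i j = if X j then (if Y i then adjMatrix G i j else 0ℚ) else (if does (i Fin.≟ P j) then 1ℚ else 0ℚ)

    N-inX : ∀ {i j} → X j ≡ true → N i j ≡ (if Y i then adjMatrix G i j else 0ℚ)
    N-inX Xj rewrite Xj = refl

    N-notX : ∀ {i j} → X j ≡ false → N i j ≡ (if does (i Fin.≟ P j) then 1ℚ else 0ℚ)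
    N-notX Xj rewrite Xj = refl

    N-P : ∀ j → N (P j) j ≡ 1ℚ
    N-P j with X j in Xj
    ... | true rewrite to∈ Xj = adjMatrix-adj G (adjacent Xj)
    ... | false = cong (if_then 1ℚ else 0ℚ) (dec-true (P′ Fin.≟ P′) refl)
      where P′ = if Y j then ψ j else j

    N≡0⊎1 : ∀ i j → N i j ≡ 0ℚ ⊎ N i j ≡ 1ℚ
    N≡0⊎1 i j with X j | Y i | adj G i j | i Fin.≟ P j
    ... | true | true | true | _ = inj₂ refl
    ... | true | true | false | _ = inj₁ refl
    ... | true | false | _ | _ = inj₁ refl
    ... | false | _ | _ | yes _ = inj₂ refl
    ... | false | _ | _ | no _ = inj₁ refl

    N≡1-inX : ∀ {i j} → X j ≡ true → N i j ≡ 1ℚ → Y i ≡ true × Adj G i j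
    N≡1-inX {i} {j} Xj Nij≡1 with Y i | N-inX {i} Xj
    ... | true | Nij≡A = refl , adjMatrix≡1⇒Adj G i j (trans (sym Nij≡A) Nij≡1)
    ... | false | Nij≡0 with () ← trans (sym Nij≡1) Nij≡0

    N≡1-notX : ∀ {i j} → X j ≡ false → N i j ≡ 1ℚ → i ≡ P j
    N≡1-notX {i} {j} Xj Nij≡1 with i Fin.≟ P j | N-notX {i} Xj
    ... | yes i≡Pj | _ = i≡Pj
    ... | no _ | Nij≡0 with () ← trans (sym Nij≡1) Nij≡0

    SupportedOnX : (Fin n → ℚ) → Set
    SupportedOnX y = ∀ j → X j ≡ false → y j ≡ 0ℚ

    N·-inY : ∀ {y} → SupportedOnX y → ∀ {i} → Y i ≡ true → (N · y) i ≡ (adjMatrix G · y) i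
    N·-inY {y} y-off {i} Yi = sumℚ-cong pointwise
      where
      pointwise : ∀ j → N i j * y j ≡ adjMatrix G i j * y j
      pointwise j with true-or-false (X j)
      ... | inj₁ Xj = cong (_* y j) (trans (N-inX Xj) (cong (if_then adjMatrix G i j else 0ℚ) Yi))
      ... | inj₂ Xj rewrite y-off j Xj = trans (ℚ.*-zeroʳ (N i j)) (sym (ℚ.*-zeroʳ (adjMatrix G i j)))

    N·-notY : ∀ {y} → SupportedOnX y → ∀ {i} → Y i ≡ false → (N · y) i ≡ 0ℚ
    N·-notY {y} y-off {i} Yi = sumℚ-zero pointwise
      where
      pointwise : ∀ j → N i j * y j ≡ 0ℚ
      pointwise j with true-or-false (X j)
      ... | inj₁ Xj = trans (cong (_* y j) (trans (N-inX Xj) (cong (if_then adjMatrix G i j else 0ℚ) Yi))) (ℚ.*-zeroˡ (y j))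
      ... | inj₂ Xj rewrite y-off j Xj = ℚ.*-zeroʳ (N i j)

    -- the maps whose term in the Leibniz expansion of det N can be nonzero
    Allowed : (Fin n → Fin n) → Set
    Allowed f = ∀ j → N (f j) j ≡ 1ℚ

    module _ {f : Fin n → Fin n} (allowed : Allowed f) where

      moved⇒inX : ∀ {c} → f c ≢ P c → X c ≡ true
      moved⇒inX {c} fc≢Pc with true-or-false (X c)
      ... | inj₁ Xc = Xc
      ... | inj₂ Xc = ⊥-elim (fc≢Pc (N≡1-notX Xc (allowed c)))

      allowed-adjacent : ∀ {c} → X c ≡ true → Adj G c (f c)
      allowed-adjacent {c} Xc = Adj-sym G (proj₂ (N≡1-inX Xc (allowed c)))

    displacement : (Fin n → Fin n) → ℕ
    displacement g = count (λ j → not (does (g j Fin.≟ P j)))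

    record Improvement (f : Fin n → Fin n) : Set where
      field
        g         : Fin n → Fin n
        allowed   : Allowed g
        same-sign : sign g ≡ sign f
        closer    : displacement g < displacement f

    -- From a column c₀ where f and P differ, follow the alternating cycle of f and P
    -- backwards (tip ↦ f⁻¹ (P tip)), composing h with one transposition per step so
    -- that h agrees with P on the columns already passed.  When the cycle closes it
    -- has length 2 (steps + 1); as this is not a multiple of 4, steps is even and the
    -- sign is unchanged.
    module AlternatingCycle {f : Fin n → Fin n} (allowed : Allowed f) (sign≢0 : sign f ≢ 0ℚ)
                            {c₀ : Fin n} (c₀-moved : f c₀ ≢ P c₀) where

      f-injective : ∀ a b → f a ≡ f b → a ≡ b
      f-injective = sign≢0⇒injective f sign≢0

      record Trail : Set where
        field
          h             : Fin n → Fin n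
          tip           : Fin n
          done          : List (Fin n)
          path          : List (Fin n)
          steps         : ℕ
          sign-h        : sign h ≡ alternating steps * sign f
          path-length   : length path ≡ steps ℕ.+ steps
          path-end      : lastOf G tip path ≡ c₀
          path-walk     : Linked (Adj G) (tip ∷ path)
          path-distinct : Unique (tip ∷ path)
          h-tip         : h tip ≡ f c₀
          h-done        : ∀ j → j ∈ done → h j ≡ P j
          h-other       : ∀ j → j ≢ tip → j ∉ done → h j ≡ f j
          tip-moved     : f tip ≢ P tip
          done-moved    : ∀ j → j ∈ done → f j ≢ P j
          tip∉done      : tip ∉ done
          path-vertices : ∀ v → v ∈ tip ∷ path → v ≡ tip ⊎ v ∈ done ⊎ ∃ λ c → c ∈ done × v ≡ P c
          f-values      : ∀ c → c ∈ tip ∷ done → f c ≡ f c₀ ⊎ ∃ λ c′ → c′ ∈ done × f c ≡ P c′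

      unvisited : Trail → Fin n → Bool
      unvisited s j = not (does (j ∈? Trail.tip s ∷ Trail.done s))

      unvisited⇒∉ : ∀ {j xs} → not (does (j ∈? xs)) ≡ true → j ∉ xs
      unvisited⇒∉ {j} {xs} unvisited j∈xs with () ← trans (sym unvisited) (cong not (dec-true (j ∈? xs) j∈xs))

      start : Trail
      start = record
        { h = f ; tip = c₀ ; done = [] ; path = [] ; steps = 0
        ; sign-h = sym (ℚ.*-identityˡ (sign f))
        ; path-length = refl ; path-end = refl ; path-walk = [-] ; path-distinct = [] ∷ []
        ; h-tip = refl ; h-done = λ _ () ; h-other = λ _ _ _ → refl
        ; tip-moved = c₀-moved ; done-moved = λ _ () ; tip∉done = λ ()
        ; path-vertices = λ { v (here v≡c₀) → inj₁ v≡c₀ }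
        ; f-values = λ { c (here refl) → inj₁ refl }
        }

      module _ (s : Trail) where
        open Trail s

        Xtip : X tip ≡ true
        Xtip = moved⇒inX allowed tip-moved

        P-tip∉path : P tip ∉ tip ∷ path
        P-tip∉path P-tip∈ with path-vertices (P tip) P-tip∈
        ... | inj₁ P-tip≡tip with () ← trans (sym (Y-P-inX Xtip)) (trans (cong Y P-tip≡tip) (disjoint Xtip))
        ... | inj₂ (inj₁ P-tip∈done) with () ← trans (sym (Y-P-inX Xtip)) (disjoint (moved⇒inX allowed (done-moved _ P-tip∈done)))
        ... | inj₂ (inj₂ (c , c∈done , P-tip≡Pc)) = tip∉done (subst (_∈ done) (sym (P-injective tip c P-tip≡Pc)) c∈done)

        close : P tip ≡ f c₀ → Improvement f
        close P-tip≡fc₀ = record { g = h ; allowed = h-allowed ; same-sign = same-sign ; closer = closer }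
          where
          cycle-not-4k : ¬ (4 ∣ 2 ℕ.+ (steps ℕ.+ steps))
          cycle-not-4k 4∣ = closed-walk-length G c4k-free (P tip) (tip ∷ path)
            (¬Any⇒All¬ _ P-tip∉path ∷ path-distinct)
            (subst (λ z → Adj G z tip) (sym (P-inX Xtip)) (adjacent Xtip) ∷ path-walk)
            (subst₂ (Adj G) (sym path-end) (sym P-tip≡fc₀) (allowed-adjacent allowed (moved⇒inX allowed c₀-moved)))
            (subst (λ m → 4 ∣ 2 ℕ.+ m) (sym path-length) 4∣)
          same-sign : sign h ≡ sign f
          same-sign = trans sign-h (trans (cong (_* sign f) (alternating-even steps cycle-not-4k)) (ℚ.*-identityˡ (sign f)))
          h≡P : ∀ {j} → j ≡ tip ⊎ j ∈ done → h j ≡ P j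
          h≡P (inj₁ refl) = trans h-tip (sym P-tip≡fc₀)
          h≡P (inj₂ j∈done) = h-done _ j∈done
          on-trail? : ∀ j → (j ≡ tip ⊎ j ∈ done) ⊎ (j ≢ tip × j ∉ done)
          on-trail? j with j Fin.≟ tip | j ∈? done
          ... | yes j≡tip | _ = inj₁ (inj₁ j≡tip)
          ... | no _ | yes j∈done = inj₁ (inj₂ j∈done)
          ... | no j≢tip | no j∉done = inj₂ (j≢tip , j∉done)
          h-allowed : Allowed h
          h-allowed j with on-trail? j
          ... | inj₁ on = subst (λ z → N z j ≡ 1ℚ) (sym (h≡P on)) (N-P j)
          ... | inj₂ (j≢tip , j∉done) = subst (λ z → N z j ≡ 1ℚ) (sym (h-other j j≢tip j∉done)) (allowed j)
          h-moved⇒f-moved : (λ j → not (does (h j Fin.≟ P j))) ⊆ᵇ (λ j → not (does (f j Fin.≟ P j)))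
          h-moved⇒f-moved j h-moved with on-trail? j
          ... | inj₁ on rewrite dec-true (h j Fin.≟ P j) (h≡P on) with () ← h-moved
          ... | inj₂ (j≢tip , j∉done) rewrite h-other j j≢tip j∉done = h-moved
          closer : displacement h < displacement f
          closer = count-mono-< h-moved⇒f-moved tip
            (cong not (dec-true (h tip Fin.≟ P tip) (h≡P (inj₁ refl))))
            (cong not (dec-false (f tip Fin.≟ P tip) tip-moved))

        module Extension (P-tip≢fc₀ : P tip ≢ f c₀) where
          c′ = proj₁ (injective⇒surjective f f-injective (P tip))
          fc′≡P-tip : f c′ ≡ P tip
          fc′≡P-tip = proj₂ (injective⇒surjective f f-injective (P tip))
          c′∉trail : c′ ∉ tip ∷ done
          c′∉trail c′∈ with f-values c′ c′∈
          ... | inj₁ fc′≡fc₀ = P-tip≢fc₀ (trans (sym fc′≡P-tip) fc′≡fc₀)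
          ... | inj₂ (c , c∈done , fc′≡Pc) =
            tip∉done (subst (_∈ done) (sym (P-injective tip c (trans (sym fc′≡P-tip) fc′≡Pc))) c∈done)
          c′≢tip : c′ ≢ tip
          c′≢tip c′≡tip = c′∉trail (here c′≡tip)
          c′∉done : c′ ∉ done
          c′∉done = c′∉trail ∘ there
          c′-moved : f c′ ≢ P c′
          c′-moved fc′≡Pc′ = c′≢tip (sym (P-injective tip c′ (trans (sym fc′≡P-tip) fc′≡Pc′)))
          Xc′ : X c′ ≡ true
          Xc′ = moved⇒inX allowed c′-moved
          ∉-Y : ∀ {v} → Y v ≡ true → c′ ≢ v
          ∉-Y Yv c′≡v with () ← trans (sym Yv) (trans (cong Y (sym c′≡v)) (disjoint Xc′))
          c′∉path : c′ ∉ P tip ∷ tip ∷ path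
          c′∉path (here c′≡P-tip) = ∉-Y (Y-P-inX Xtip) c′≡P-tip
          c′∉path (there c′∈) with path-vertices c′ c′∈
          ... | inj₁ c′≡tip = c′≢tip c′≡tip
          ... | inj₂ (inj₁ c′∈done) = c′∉done c′∈done
          ... | inj₂ (inj₂ (c , c∈done , c′≡Pc)) = ∉-Y (Y-P-inX (moved⇒inX allowed (done-moved c c∈done))) c′≡Pc
          τ = transpose tip c′
          s′ : Trail
          s′ = record
            { h = λ j → h (τ j) ; tip = c′ ; done = tip ∷ done ; path = P tip ∷ tip ∷ path ; steps = ℕ.suc steps
            ; sign-h = trans (sign-transpose h tip c′ (c′≢tip ∘ sym))
                             (trans (cong -_ sign-h) (ℚ.neg-distribˡ-* (alternating steps) (sign f)))
            ; path-length = trans (cong (ℕ.suc ∘ ℕ.suc) path-length) (cong ℕ.suc (sym (ℕ.+-suc steps steps)))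
            ; path-end = path-end
            ; path-walk = subst (Adj G c′) fc′≡P-tip (allowed-adjacent allowed Xc′)
                          ∷ subst (λ z → Adj G z tip) (sym (P-inX Xtip)) (adjacent Xtip) ∷ path-walk
            ; path-distinct = ¬Any⇒All¬ _ c′∉path ∷ ¬Any⇒All¬ _ P-tip∉path ∷ path-distinct
            ; h-tip = trans (cong h (transpose-matchʳ tip c′)) h-tip
            ; h-done = h-done′
            ; h-other = λ j j≢c′ j∉ → trans (cong h (transpose-other (j∉ ∘ here) j≢c′)) (h-other j (j∉ ∘ here) (j∉ ∘ there))
            ; tip-moved = c′-moved
            ; done-moved = λ { j (here refl) → tip-moved ; j (there j∈done) → done-moved j j∈done }
            ; tip∉done = c′∉trail
            ; path-vertices = path-vertices′
            ; f-values = f-values′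
            }
            where
            h-done′ : ∀ j → j ∈ tip ∷ done → h (τ j) ≡ P j
            h-done′ j (here refl) = trans (cong h (transpose-matchˡ tip c′)) (trans (h-other c′ c′≢tip c′∉done) fc′≡P-tip)
            h-done′ j (there j∈done) =
              trans (cong h (transpose-other (λ j≡tip → tip∉done (subst (_∈ done) j≡tip j∈done))
                                             (λ j≡c′ → c′∉done (subst (_∈ done) j≡c′ j∈done))))
                    (h-done j j∈done)
            path-vertices′ : ∀ v → v ∈ c′ ∷ P tip ∷ tip ∷ path →
              v ≡ c′ ⊎ v ∈ tip ∷ done ⊎ ∃ λ c → c ∈ tip ∷ done × v ≡ P c
            path-vertices′ v (here v≡c′) = inj₁ v≡c′
            path-vertices′ v (there (here v≡P-tip)) = inj₂ (inj₂ (tip , here refl , v≡P-tip))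
            path-vertices′ v (there (there v∈)) with path-vertices v v∈
            ... | inj₁ v≡tip = inj₂ (inj₁ (here v≡tip))
            ... | inj₂ (inj₁ v∈done) = inj₂ (inj₁ (there v∈done))
            ... | inj₂ (inj₂ (c , c∈done , v≡Pc)) = inj₂ (inj₂ (c , there c∈done , v≡Pc))
            f-values′ : ∀ c → c ∈ c′ ∷ tip ∷ done → f c ≡ f c₀ ⊎ ∃ λ c″ → c″ ∈ tip ∷ done × f c ≡ P c″
            f-values′ c (here refl) = inj₂ (tip , here refl , fc′≡P-tip)
            f-values′ c (there c∈) with f-values c c∈
            ... | inj₁ fc≡fc₀ = inj₁ fc≡fc₀
            ... | inj₂ (c″ , c″∈done , fc≡Pc″) = inj₂ (c″ , there c″∈done , fc≡Pc″)
          fewer-unvisited : count (unvisited s′) < count (unvisited s)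
          fewer-unvisited = count-mono-< still-unvisited c′
            (cong not (dec-true (c′ ∈? c′ ∷ tip ∷ done) (here refl)))
            (cong not (dec-false (c′ ∈? tip ∷ done) c′∉trail))
            where
            still-unvisited : unvisited s′ ⊆ᵇ unvisited s
            still-unvisited j unvisited′ = cong not (dec-false (j ∈? tip ∷ done) (unvisited⇒∉ unvisited′ ∘ there))

        extend : P tip ≢ f c₀ → Σ Trail λ s′ → count (unvisited s′) < count (unvisited s)
        extend P-tip≢fc₀ = s′ , fewer-unvisited
          where open Extension P-tip≢fc₀

      walk : ∀ k (s : Trail) → count (unvisited s) ≤ k → Improvement f
      walk k s bound with P (Trail.tip s) Fin.≟ f c₀
      ... | yes closes = close s closes
      ... | no stays-open with extend s stays-open | k
      ...   | _ , fewer | ℕ.zero = ⊥-elim (ℕ.n≮0 (ℕ.<-≤-trans fewer bound))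
      ...   | s′ , fewer | ℕ.suc k′ = walk k′ s′ (ℕ.≤-pred (ℕ.<-≤-trans fewer bound))

      improvement : Improvement f
      improvement = walk n start (count≤n (unvisited start))

    sign-uniform-≤ : ∀ k f → displacement f ≤ k → Allowed f → sign f ≢ 0ℚ → sign f ≡ sign P
    sign-uniform-≤ k f bound allowed sign≢0 with Fin.any? (λ j → ¬? (f j Fin.≟ P j))
    ... | no f≗P = sign-cong (λ j → decidable-stable (f j Fin.≟ P j) (f≗P ∘ (j ,_)))
    ... | yes (c₀ , c₀-moved) with AlternatingCycle.improvement allowed sign≢0 c₀-moved | k
    ...   | better | ℕ.zero = ⊥-elim (ℕ.n≮0 (ℕ.<-≤-trans (Improvement.closer better) bound))
    ...   | better | ℕ.suc k′ = trans (sym same-sign)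
            (sign-uniform-≤ k′ g (ℕ.≤-pred (ℕ.<-≤-trans closer bound)) g-allowed
                            (λ sign-g≡0 → sign≢0 (trans (sym same-sign) sign-g≡0)))
      where open Improvement better renaming (allowed to g-allowed)

    sign-uniform : ∀ f → Allowed f → sign f ≢ 0ℚ → sign f ≡ sign P
    sign-uniform f = sign-uniform-≤ n f (count≤n _)

    allowed? : ∀ f → Dec (Allowed f)
    allowed? f = Fin.all? (λ j → N (f j) j ℚ.≟ 1ℚ)

    contribution : ∀ {f} → Dec (Allowed f) → Dec (sign f ≡ 0ℚ) → ℚ
    contribution (yes _) (no _) = 1ℚ
    contribution (yes _) (yes _) = 0ℚ
    contribution (no _) _ = 0ℚ

    contributes : (Fin n → Fin n) → ℚ
    contributes f = contribution (allowed? f) (sign f ℚ.≟ 0ℚ)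

    leibnizTerm-N : ∀ f → leibnizTerm N f ≡ sign P * contributes f
    leibnizTerm-N f = by-cases (allowed? f) (sign f ℚ.≟ 0ℚ)
      where
      open ≡-Reasoning
      by-cases : (a : Dec (Allowed f)) (z : Dec (sign f ≡ 0ℚ)) → leibnizTerm N f ≡ sign P * contribution a z
      by-cases (yes allowed) (no sign≢0) = begin
        sign f * prodℚ (λ j → N (f j) j)  ≡⟨ cong (sign f *_) (prodℚ-one _ allowed) ⟩
        sign f * 1ℚ                        ≡⟨ cong (_* 1ℚ) (sign-uniform f allowed sign≢0) ⟩
        sign P * 1ℚ                        ∎
      by-cases (yes _) (yes sign≡0) = begin
        sign f * prodℚ (λ j → N (f j) j)  ≡⟨ cong (_* prodℚ (λ j → N (f j) j)) sign≡0 ⟩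
        0ℚ * prodℚ (λ j → N (f j) j)      ≡⟨ ℚ.*-zeroˡ (prodℚ (λ j → N (f j) j)) ⟩
        0ℚ                                 ≡⟨ ℚ.*-zeroʳ (sign P) ⟨
        sign P * 0ℚ                        ∎
      by-cases (no not-allowed) _ = begin
        sign f * prodℚ (λ j → N (f j) j)  ≡⟨ cong (sign f *_) (prodℚ-zero _ j Nfj≡0) ⟩
        sign f * 0ℚ                        ≡⟨ ℚ.*-zeroʳ (sign f) ⟩
        0ℚ                                 ≡⟨ ℚ.*-zeroʳ (sign P) ⟨
        sign P * 0ℚ                        ∎
        where
        witness = Fin.¬∀⟶∃¬ n _ (λ j → N (f j) j ℚ.≟ 1ℚ) not-allowed
        j = proj₁ witness
        Nfj≡0 : N (f j) j ≡ 0ℚ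
        Nfj≡0 with N≡0⊎1 (f j) j
        ... | inj₁ Nfj≡0 = Nfj≡0
        ... | inj₂ Nfj≡1 = ⊥-elim (proj₂ witness Nfj≡1)

    det-N≢0 : det N ≢ 0ℚ
    det-N≢0 detN≡0 = p*q≢0 sign-P≢0 (λ s≡0 → ℚ.<⇒≢ total-pos (sym s≡0)) (begin
      sign P * sumMaps contributes             ≡⟨ sumMaps-*ˡ (sign P) contributes ⟨
      sumMaps (λ f → sign P * contributes f)  ≡⟨ sumMaps-cong leibnizTerm-N ⟨
      det N                                    ≡⟨ detN≡0 ⟩
      0ℚ                                       ∎)
      where
      open ≡-Reasoning
      sign-P≢0 : sign P ≢ 0ℚ
      sign-P≢0 = injective⇒sign≢0 P P-injective
      contribution≥0 : ∀ {f} (a : Dec (Allowed f)) (z : Dec (sign f ≡ 0ℚ)) → 0ℚ ≤ℚ contribution a z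
      contribution≥0 (yes _) (no _) = ℚ.<⇒≤ (ℚ.positive⁻¹ 1ℚ)
      contribution≥0 (yes _) (yes _) = ℚ.≤-refl
      contribution≥0 (no _) _ = ℚ.≤-refl
      contribution-P : ∀ g → (∀ j → g j ≡ P j) → (a : Dec (Allowed g)) (z : Dec (sign g ≡ 0ℚ)) → 0ℚ <ℚ contribution a z
      contribution-P g g≗P (yes _) (no _) = ℚ.positive⁻¹ 1ℚ
      contribution-P g g≗P (yes _) (yes sign-g≡0) = ⊥-elim (sign-P≢0 (trans (sign-cong (sym ∘ g≗P)) sign-g≡0))
      contribution-P g g≗P (no not-allowed) _ = ⊥-elim (not-allowed (λ j → subst (λ z → N z j ≡ 1ℚ) (sym (g≗P j)) (N-P j)))
      total-pos : 0ℚ <ℚ sumMaps contributes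
      total-pos = sumMaps-pos contributes (λ f → contribution≥0 (allowed? f) (sign f ℚ.≟ 0ℚ)) P
                              (λ g g≗P → contribution-P g g≗P (allowed? g) (sign g ℚ.≟ 0ℚ))

    minor-kernel-trivial : ∀ y → SupportedOnX y → (∀ i → Y i ≡ true → (adjMatrix G · y) i ≡ 0ℚ) → ∀ j → y j ≡ 0ℚ
    minor-kernel-trivial y y-off Ay≡0 = det≢0⇒kernel-trivial N det-N≢0 y Ny≡0
      where
      Ny≡0 : ∀ i → (N · y) i ≡ 0ℚ
      Ny≡0 i with true-or-false (Y i)
      ... | inj₁ Yi = trans (N·-inY y-off Yi) (Ay≡0 i Yi)
      ... | inj₂ Yi = N·-notY y-off Yi

    N-solvable : ∀ (b : Fin n → ℚ) → ∃ λ w → ∀ i → (N · w) i ≡ b i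
    N-solvable = kernel-trivial⇒solvable N (det≢0⇒kernel-trivial N det-N≢0)

    solution-supportedOnX : ∀ {b w : Fin n → ℚ} → (∀ i → (N · w) i ≡ (if Y i then b i else 0ℚ)) → SupportedOnX w
    solution-supportedOnX {b} {w} Nw≡b′ j Xj = begin
      w j                                ≡⟨ ℚ.*-identityˡ (w j) ⟨
      1ℚ * w j                           ≡⟨ cong (_* w j) (N-P j) ⟨
      N (P j) j * w j                    ≡⟨ sumℚ-single (λ l → N (P j) l * w l) j others-vanish ⟨
      (N · w) (P j)                      ≡⟨ Nw≡b′ (P j) ⟩
      (if Y (P j) then b (P j) else 0ℚ)  ≡⟨ cong (if_then b (P j) else 0ℚ) (Y-P-notX Xj) ⟩
      0ℚ                                 ∎
      where
      open ≡-Reasoning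
      others-vanish : ∀ l → l ≢ j → N (P j) l * w l ≡ 0ℚ
      others-vanish l l≢j with true-or-false (X l)
      ... | inj₁ Xl = trans (cong (_* w l) (trans (N-inX Xl) (cong (if_then adjMatrix G (P j) l else 0ℚ) (Y-P-notX Xj))))
                            (ℚ.*-zeroˡ (w l))
      ... | inj₂ Xl = trans (cong (_* w l) (trans (N-notX Xl) (cong (if_then 1ℚ else 0ℚ)
                              (dec-false (P j Fin.≟ P l) (l≢j ∘ sym ∘ P-injective j l)))))
                            (ℚ.*-zeroˡ (w l))

    minor-solvable : ∀ (b : Fin n → ℚ) → ∃ λ w → SupportedOnX w × (∀ i → Y i ≡ true → (adjMatrix G · w) i ≡ b i)
    minor-solvable b = w , w-off , λ i Yi → trans (sym (N·-inY w-off Yi)) (trans (Nw≡b′ i) (cong (if_then b i else 0ℚ) Yi))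
      where
      solution = N-solvable (λ i → if Y i then b i else 0ℚ)
      w = proj₁ solution
      Nw≡b′ = proj₂ solution
      w-off = solution-supportedOnX Nw≡b′

module IndependentSets where

  open BooleanSets
  open HallsTheorem using (neighbours; neighbours-intro; neighbours-elim)
  open GraphBasics using (Adj-sym)
  open import Data.Nat as ℕ using (ℕ; _+_; _≤_; _<_; z≤n)
  import Data.Nat.Properties as ℕ
  import Data.Fin.Properties as Fin
  open import Data.Fin.Subset using (Subset; _∈_; _∉_; ∣_∣) renaming (⊥ to ∅)
  open import Data.Fin.Subset.Properties using (anySubset?; _∈?_; ∣p∣≤n; ∉⊥)
  open import Data.Vec using ([]; _∷_; lookup; tabulate)
  open import Data.Vec.Properties using (lookup∘tabulate; []=⇒lookup; lookup⇒[]=)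
  import Data.Bool as Bool
  open import Relation.Nullary using (¬?)
  open import Data.Bool.Properties using (∨-zeroʳ)
  open import Function using (_∘_)
  open import Relation.Nullary.Decidable using (_×-dec_; _→-dec_)
  open import Algebra.Properties.CommutativeSemigroup ℕ.+-commutativeSemigroup using (xy∙z≈xz∙y)

  ∈⇒lookup : ∀ {n} {i : Fin n} {S : Subset n} → i ∈ S → lookup S i ≡ true
  ∈⇒lookup = []=⇒lookup

  lookup⇒∈ : ∀ {n} {i : Fin n} {S : Subset n} → lookup S i ≡ true → i ∈ S
  lookup⇒∈ {i = i} {S} = lookup⇒[]= i S

  ∉⇒lookup≡false : ∀ {n} {i : Fin n} {S : Subset n} → i ∉ S → lookup S i ≡ false
  ∉⇒lookup≡false {i = i} {S} i∉S with lookup S i in Si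
  ... | false = refl
  ... | true = ⊥-elim (i∉S (lookup⇒∈ Si))

  ∣∣≡count : ∀ {n} (S : Subset n) → ∣ S ∣ ≡ count (lookup S)
  ∣∣≡count [] = refl
  ∣∣≡count (true ∷ S) = cong ℕ.suc (∣∣≡count S)
  ∣∣≡count (false ∷ S) = ∣∣≡count S

  ∣tabulate∣≡count : ∀ {n} (p : Fin n → Bool) → ∣ tabulate p ∣ ≡ count p
  ∣tabulate∣≡count p = trans (∣∣≡count (tabulate p)) (count-cong (lookup∘tabulate p))

  module _ {n} (G : Graph n) where

    Independentᵇ : (Fin n → Bool) → Set
    Independentᵇ p = ∀ i j → p i ≡ true → p j ≡ true → ¬ Adj G i j

    independent⇒ᵇ : ∀ {S} → Independent G S → Independentᵇ (lookup S)
    independent⇒ᵇ indS i j Si Sj = indS i j (lookup⇒∈ Si) (lookup⇒∈ Sj)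

    ᵇ⇒independent : ∀ {p} → Independentᵇ p → Independent G (tabulate p)
    ᵇ⇒independent {p} indp i j i∈ j∈ =
      indp i j (trans (sym (lookup∘tabulate p i)) (∈⇒lookup i∈)) (trans (sym (lookup∘tabulate p j)) (∈⇒lookup j∈))

    maximum-count : ∀ {S p} → MaximumIndependent G S → Independentᵇ p → count p ≤ count (lookup S)
    maximum-count {S} {p} (_ , maxS) indp =
      subst₂ _≤_ (∣tabulate∣≡count p) (∣∣≡count S) (maxS (tabulate p) (ᵇ⇒independent indp))

    independent? : ∀ S → Dec (Independent G S)
    independent? S = Fin.all? λ i → Fin.all? λ j →
      (i ∈? S) →-dec ((j ∈? S) →-dec ¬? (adj G i j Bool.≟ true))

    maximumIndependent-≤ : ∀ k → (∀ T → Independent G T → ∣ T ∣ ≤ k) → Σ (Subset n) (MaximumIndependent G)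
    maximumIndependent-≤ ℕ.zero bound = ∅ , (λ i j i∈∅ → ⊥-elim (∉⊥ i∈∅)) , λ T indT → ℕ.≤-trans (bound T indT) z≤n
    maximumIndependent-≤ (ℕ.suc k) bound with anySubset? (λ S → independent? S ×-dec (ℕ.suc k ℕ.≤? ∣ S ∣))
    ... | yes (S , indS , k<∣S∣) = S , indS , λ T indT → ℕ.≤-trans (bound T indT) k<∣S∣
    ... | no none = maximumIndependent-≤ k (λ T indT → ℕ.≤-pred (ℕ.≰⇒> (λ k<∣T∣ → none (T , indT , k<∣T∣))))

    maximumIndependent : Σ (Subset n) (MaximumIndependent G)
    maximumIndependent = maximumIndependent-≤ n (λ T _ → ∣p∣≤n T)

    edgesInto : (Fin n → Bool) → Fin n → Fin n → Bool
    edgesInto S x y = S y ∧ adj G x y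

    neighboursIn : (Fin n → Bool) → (Fin n → Bool) → Fin n → Bool
    neighboursIn S = neighbours (edgesInto S)

    exchange : (Fin n → Bool) → (Fin n → Bool) → Fin n → Bool
    exchange S W i = (S i ∧ not (neighboursIn S W i)) ∨ W i

    module _ {S W : Fin n → Bool} (indS : Independentᵇ S) (indW : Independentᵇ W)
             (W∩S≡∅ : ∀ i → W i ≡ true → S i ≡ false) where

      private
        N = neighboursIn S W

        kept : ∀ {i} → (S i ∧ not (N i)) ≡ true → S i ≡ true × N i ≡ false
        kept kept-i = let (Si , ¬Ni) = ∧-true kept-i in Si , not≡true⇒≡false ¬Ni

        W-S-nonadjacent : ∀ {i j} → W i ≡ true → (S j ∧ not (N j)) ≡ true → ¬ Adj G i j
        W-S-nonadjacent {i} {j} Wi kept-j i~j with () ←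
          trans (sym (neighbours-intro (edgesInto S) W {y = j} Wi (cong₂ _∧_ (proj₁ (kept kept-j)) i~j))) (proj₂ (kept kept-j))

      exchange-independent : Independentᵇ (exchange S W)
      exchange-independent i j Ti Tj with ∨-true Ti | ∨-true Tj
      ... | inj₁ kept-i | inj₁ kept-j = indS i j (proj₁ (kept kept-i)) (proj₁ (kept kept-j))
      ... | inj₂ Wi | inj₂ Wj = indW i j Wi Wj
      ... | inj₂ Wi | inj₁ kept-j = W-S-nonadjacent Wi kept-j
      ... | inj₁ kept-i | inj₂ Wj = W-S-nonadjacent Wj kept-i ∘ Adj-sym G

      exchange-count : count (exchange S W) + count N ≡ count S + count W
      exchange-count = begin
        count (exchange S W) + count N    ≡⟨ cong (_+ count N) (count-∨-disjoint _ W (λ i → S⇒¬W ∘ proj₁ ∘ ∧-true)) ⟩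
        (count S∖N + count W) + count N   ≡⟨ xy∙z≈xz∙y (count S∖N) (count W) (count N) ⟩
        (count S∖N + count N) + count W   ≡⟨ cong (_+ count W) (count-split S N N⊆S) ⟨
        count S + count W                 ∎
        where
        open ≡-Reasoning
        S∖N = λ i → S i ∧ not (N i)
        S⇒¬W : ∀ {i} → S i ≡ true → W i ≡ false
        S⇒¬W {i} Si with W i in Wi
        ... | false = refl
        ... | true with () ← trans (sym Si) (W∩S≡∅ i Wi)
        N⊆S : N ⊆ᵇ S
        N⊆S y Ny = let (_ , _ , S∧adj) = neighbours-elim (edgesInto S) W Ny in proj₁ (∧-true S∧adj)

    maximum⇒enough-neighbours : ∀ {S W} → MaximumIndependent G S → Independentᵇ W → (∀ i → W i ≡ true → lookup S i ≡ false) →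
      count W ≤ count (neighboursIn (lookup S) W)
    maximum⇒enough-neighbours {S} {W} maxS indW W∩S≡∅ = ℕ.+-cancelˡ-≤ (count (lookup S)) (count W) (count N) (begin
      count (lookup S) + count W      ≡⟨ exchange-count (independent⇒ᵇ (proj₁ maxS)) indW W∩S≡∅ ⟨
      count (exchange (lookup S) W) + count N  ≤⟨ ℕ.+-monoˡ-≤ (count N) (maximum-count maxS (exchange-independent (independent⇒ᵇ (proj₁ maxS)) indW W∩S≡∅)) ⟩
      count (lookup S) + count N      ∎)
      where
      open ℕ.≤-Reasoning
      N = neighboursIn (lookup S) W

    unique-maximum⇒more-neighbours : ∀ {S W} → MaximumIndependent G S → (∀ T → MaximumIndependent G T → T ≡ S) →
      Independentᵇ W → (∀ i → W i ≡ true → lookup S i ≡ false) → ∀ {i₀} → W i₀ ≡ true →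
      count W < count (neighboursIn (lookup S) W)
    unique-maximum⇒more-neighbours {S} {W} maxS unique indW W∩S≡∅ {i₀} Wi₀ = ℕ.≰⇒> N≰W
      where
      indS = independent⇒ᵇ (proj₁ maxS)
      T = exchange (lookup S) W
      N = neighboursIn (lookup S) W
      Ti₀ : T i₀ ≡ true
      Ti₀ = trans (cong ((lookup S i₀ ∧ not (N i₀)) ∨_) Wi₀) (∨-zeroʳ _)
      T-maximum : count N ≤ count W → MaximumIndependent G (tabulate T)
      T-maximum N≤W = ᵇ⇒independent (exchange-independent indS indW W∩S≡∅) , λ U indU →
        ℕ.≤-trans (proj₂ maxS U indU) (subst₂ _≤_ (sym (∣∣≡count S)) (sym (∣tabulate∣≡count T)) S≤T)
        where
        open ℕ.≤-Reasoning
        S≤T : count (lookup S) ≤ count T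
        S≤T = ℕ.+-cancelʳ-≤ (count N) (count (lookup S)) (count T) (begin
          count (lookup S) + count N  ≤⟨ ℕ.+-monoʳ-≤ (count (lookup S)) N≤W ⟩
          count (lookup S) + count W  ≡⟨ exchange-count indS indW W∩S≡∅ ⟨
          count T + count N           ∎)
      N≰W : ¬ (count N ≤ count W)
      N≰W N≤W with () ← trans (sym Ti₀) (trans (sym (lookup∘tabulate T i₀))
                          (trans (cong (λ U → lookup U i₀) (unique (tabulate T) (T-maximum N≤W))) (W∩S≡∅ i₀ Wi₀)))


    maximum⇒dominating : ∀ {S} → MaximumIndependent G S → ∀ {v} → v ∉ S → ∃ λ u → u ∈ S × Adj G v u
    maximum⇒dominating {S} maxS {v} v∉S with Fin.any? (λ u → (u ∈? S) ×-dec (adj G v u Bool.≟ true))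
    ... | yes found = found
    ... | no isolated = ⊥-elim (ℕ.<-irrefl refl (ℕ.<-≤-trans larger (maximum-count maxS indT)))
      where
      s = lookup S
      T : Fin n → Bool
      T i = s i ∨ singleton v i
      s⇒≢v : ∀ {i} → s i ≡ true → singleton v i ≡ false
      s⇒≢v {i} si = singleton-other (λ i≡v → v∉S (subst (_∈ S) i≡v (lookup⇒∈ si)))
      larger : count s < count T
      larger = begin-strict
        count s                           <⟨ ℕ.n<1+n (count s) ⟩
        ℕ.suc (count s)                   ≡⟨ ℕ.+-comm 1 (count s) ⟩
        count s + 1                       ≡⟨ cong (count s +_) (count-singleton v) ⟨
        count s + count (singleton v)     ≡⟨ count-∨-disjoint s (singleton v) (λ i → s⇒≢v) ⟨
        count T                           ∎
        where open ℕ.≤-Reasoning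
      not-adjacent-to-v : ∀ {u} → s u ≡ true → ¬ Adj G v u
      not-adjacent-to-v {u} su v~u = isolated (u , lookup⇒∈ su , v~u)
      indT : Independentᵇ T
      indT i j Ti Tj i~j with ∨-true Ti | ∨-true Tj
      ... | inj₁ si | inj₁ sj = independent⇒ᵇ (proj₁ maxS) i j si sj i~j
      ... | inj₁ si | inj₂ j≡v = not-adjacent-to-v si (Adj-sym G (subst (Adj G i) (singleton⇒≡ j≡v) i~j))
      ... | inj₂ i≡v | inj₁ sj = not-adjacent-to-v sj (subst (λ k → Adj G k j) (singleton⇒≡ i≡v) i~j)
      ... | inj₂ i≡v | inj₂ j≡v with () ← trans (sym (subst₂ (Adj G) (singleton⇒≡ i≡v) (singleton⇒≡ j≡v) i~j)) (Graph.irrefl G v)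

module SupportAndCore where

  open FiniteSums
  open BooleanSets
  open HallsTheorem
  open GraphBasics
  open MatchedMinors using (minor-kernel-trivial; minor-solvable)
  open IndependentSets
  open import Data.Nat as ℕ using (ℕ; _≤_; z≤n)
  import Data.Nat.Properties as ℕ
  import Data.Fin.Properties as Fin
  open import Data.Fin.Subset using (_∈_; _∉_)
  open import Data.Fin.Subset.Properties using (_∈?_; ⊆-antisym)
  open import Data.Vec using (lookup)
  import Data.Bool as Bool
  open import Data.Bool.Properties using (¬-not; ∨-zeroʳ; ∨-identityʳ)
  open import Data.Rational using (ℚ; 0ℚ; 1ℚ; _+_; _*_; -_)
  import Data.Rational.Properties as ℚ
  open import Relation.Nullary.Decidable using (dec-true; _×-dec_)
  open import Function using (_∘_)
  open import Data.Sum using ([_,_]′)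

  module MatchingImage {n} (G : Graph n) {X : Fin n → Bool} {R : Fin n → Fin n → Bool} (m : Matching X R)
                       (leaves : ∀ {x y} → X x ≡ true → R x y ≡ true → Adj G x y × X y ≡ false) where

    open Matching m renaming (partner to φ)

    Preimage : Fin n → Set
    Preimage y = ∃ λ x → X x ≡ true × φ x ≡ y

    preimage? : ∀ y → Dec (Preimage y)
    preimage? y = Fin.any? λ x → (X x Bool.≟ true) ×-dec (φ x Fin.≟ y)

    image : Fin n → Bool
    image y = does (preimage? y)

    private
      choose : ∀ {y} → Dec (Preimage y) → Fin n
      choose (yes (x , _)) = x
      choose {y} (no _) = y

      choose-spec : ∀ {y} (d : Dec (Preimage y)) → does d ≡ true → X (choose d) ≡ true × φ (choose d) ≡ y
      choose-spec (yes (_ , Xx , φx≡y)) _ = Xx , φx≡y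

    preimage : Fin n → Fin n
    preimage y = choose (preimage? y)

    image-φ : ∀ {x} → X x ≡ true → image (φ x) ≡ true
    image-φ {x} Xx = dec-true (preimage? (φ x)) (x , Xx , refl)

    preimage∈X : ∀ {y} → image y ≡ true → X (preimage y) ≡ true
    preimage∈X {y} im = proj₁ (choose-spec (preimage? y) im)

    φ-preimage : ∀ {y} → image y ≡ true → φ (preimage y) ≡ y
    φ-preimage {y} im = proj₂ (choose-spec (preimage? y) im)

    onto-image : PerfectMatching G X image
    onto-image = record
      { to = φ ; from = preimage ; to∈ = image-φ ; from∈ = preimage∈X
      ; from-to = λ Xx → injective (preimage∈X (image-φ Xx)) Xx (φ-preimage (image-φ Xx))
      ; to-from = φ-preimage
      ; disjoint = disjoint
      ; adjacent = λ {x} Xx → Adj-sym G (proj₁ (leaves Xx (related x Xx)))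
      }
      where
      disjoint : ∀ {i} → X i ≡ true → image i ≡ false
      disjoint {i} Xi with image i in im
      ... | false = refl
      ... | true with () ← trans (sym Xi) (trans (cong X (sym (φ-preimage im)))
                            (proj₂ (leaves (preimage∈X im) (related _ (preimage∈X im)))))

  module _ {n} (G : Graph n) (bipartite : Bipartite G) (c4k-free : C4kFree G) where

    colour : Fin n → Bool
    colour = proj₁ bipartite

    inClass : Bool → Fin n → Bool
    inClass b i = does (colour i Bool.≟ b)

    inClass⇒≡ : ∀ {b i} → inClass b i ≡ true → colour i ≡ b
    inClass⇒≡ {b} {i} _ with colour i Bool.≟ b
    ... | yes colour≡b = colour≡b

    ≡⇒inClass : ∀ {b i} → colour i ≡ b → inClass b i ≡ true
    ≡⇒inClass {b} {i} = dec-true (colour i Bool.≟ b)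

    class-independent : ∀ b {W} → W ⊆ᵇ inClass b → Independentᵇ G W
    class-independent b W⊆b i j Wi Wj i~j =
      proj₂ bipartite i j i~j (trans (inClass⇒≡ (W⊆b i Wi)) (sym (inClass⇒≡ (W⊆b j Wj))))

    other-end : ∀ {b i j} → Adj G i j → colour i ≢ b → colour j ≡ b
    other-end {b} {i} {j} i~j ci≢b = trans (¬-not (λ cj≡ci → proj₂ bipartite i j i~j (sym cj≡ci))) (sym (¬-not (ci≢b ∘ sym)))

    supp⊆maximum : ∀ {T} → MaximumIndependent G T → ∀ {v} → InSupp G v → v ∈ T
    supp⊆maximum {T} maxT {v} (x , x-null , xv≢0) with v ∈? T
    ... | yes v∈T = v∈T
    ... | no v∉T = ⊥-elim (xv≢0 xv≡0)
      where
      t = lookup T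
      b = colour v
      X : Fin n → Bool
      X i = not (t i) ∧ inClass b i
      R = edgesInto G t
      hall-condition : HallCondition X R
      hall-condition W W⊆X = maximum⇒enough-neighbours G {S = T} {W = W} maxT
        (class-independent b (λ i Wi → proj₂ (∧-true (W⊆X i Wi))))
        (λ i Wi → not≡true⇒≡false (proj₁ (∧-true (W⊆X i Wi))))
      matching = hall X R hall-condition
      open Matching matching renaming (partner to φ)
      leaves : ∀ {x y} → X x ≡ true → R x y ≡ true → Adj G x y × X y ≡ false
      leaves {y = y} Xx Rxy = let (ty , x~y) = ∧-true Rxy in x~y , cong (λ s → not s ∧ inClass b y) ty
      open MatchingImage G matching leaves renaming (image to Im)
      Im-neighbours : ∀ {i j} → Im i ≡ true → Adj G i j → X j ≡ true
      Im-neighbours {i} {j} im i~j = cong₂ _∧_ (cong not tj≡false) (≡⇒inClass (other-end i~j ci≢b))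
        where
        x′ = preimage i
        Xx′ = preimage∈X im
        φx′≡i = φ-preimage im
        ti : t i ≡ true
        ti = subst (λ z → t z ≡ true) φx′≡i (proj₁ (∧-true (related x′ Xx′)))
        ci≢b : colour i ≢ b
        ci≢b ci≡b = proj₂ bipartite x′ i (subst (Adj G x′) φx′≡i (proj₂ (∧-true (related x′ Xx′))))
                      (trans (inClass⇒≡ (proj₂ (∧-true Xx′))) (sym ci≡b))
        tj≡false : t j ≡ false
        tj≡false with t j in tj
        ... | false = refl
        ... | true = ⊥-elim (independent⇒ᵇ G (proj₁ maxT) i j ti tj i~j)
      y : Fin n → ℚ
      y j = if X j then x j else 0ℚ
      Ay≡0 : ∀ i → Im i ≡ true → (adjMatrix G · y) i ≡ 0ℚ
      Ay≡0 i im = trans (sumℚ-cong (λ j → adjMatrix-*-cong G {x = y} {y = x} (λ i~j → cong (if_then x j else 0ℚ) (Im-neighbours im i~j))))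
                        (x-null i)
      Xv : X v ≡ true
      Xv = cong₂ _∧_ (cong not (∉⇒lookup≡false v∉T)) (≡⇒inClass refl)
      xv≡0 : x v ≡ 0ℚ
      xv≡0 = trans (sym (cong (if_then x v else 0ℚ) Xv))
                   (minor-kernel-trivial G c4k-free onto-image y (λ j Xj → cong (if_then x j else 0ℚ) Xj) Ay≡0 v)

    unique-maximum⊆supp : ∀ {S} → MaximumIndependent G S → (∀ T → MaximumIndependent G T → T ≡ S) →
      ∀ {v} → v ∈ S → InSupp G v
    unique-maximum⊆supp {S} maxS unique {v} v∈S =
      let (w , w-off , Aw) = minor-solvable G c4k-free (flip onto-image) (λ i → - adjMatrix G i v) in null-vector w-off Aw
      where
      s = lookup S
      b = colour v
      K : Fin n → Bool
      K i = not (s i) ∧ not (inClass b i)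
      S′ : Fin n → Bool
      S′ y = s y ∧ inClass b y ∧ not (singleton v y)
      R = edgesInto G S′

      K-outside : ∀ {i} → K i ≡ true → s i ≡ false
      K-outside Ki = not≡true⇒≡false (proj₁ (∧-true Ki))
      K-colour : ∀ {i} → K i ≡ true → colour i ≢ b
      K-colour Ki ci≡b with () ← trans (sym (proj₂ (∧-true Ki))) (cong not (≡⇒inClass ci≡b))

      hall-condition : HallCondition K R
      hall-condition W W⊆K with anyᵇ W in anyW
      ... | false = subst (_≤ count (neighbours R W)) (sym (count-empty (anyᵇ-false W anyW))) z≤n
      ... | true = ℕ.≤-pred (begin
        ℕ.suc (count W)                                ≤⟨ unique-maximum⇒more-neighbours G {S = S} {W = W} maxS unique
                                                            indW (λ i → K-outside ∘ W⊆K i) (proj₂ (anyᵇ-elim W anyW)) ⟩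
        count (neighboursIn G s W)                     ≤⟨ count-mono N⊆ ⟩
        count (λ y → neighbours R W y ∨ singleton v y) ≤⟨ count-∨-≤ (neighbours R W) (singleton v) ⟩
        count (neighbours R W) ℕ.+ count (singleton v) ≡⟨ cong (count (neighbours R W) ℕ.+_) (count-singleton v) ⟩
        count (neighbours R W) ℕ.+ 1                   ≡⟨ ℕ.+-comm (count (neighbours R W)) 1 ⟩
        ℕ.suc (count (neighbours R W))                 ∎)
        where
        open ℕ.≤-Reasoning
        indW : Independentᵇ G W
        indW = class-independent (not b) (λ i Wi → ≡⇒inClass (¬-not (K-colour (W⊆K i Wi))))
        N⊆ : neighboursIn G s W ⊆ᵇ (λ y → neighbours R W y ∨ singleton v y)
        N⊆ y Ny with v Fin.≟ y
        ... | yes refl = trans (cong (neighbours R W y ∨_) (singleton-self y)) (∨-zeroʳ _)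
        ... | no v≢y with neighbours-elim (edgesInto G s) W Ny
        ...   | x , Wx , sy∧x~y = trans (cong (neighbours R W y ∨_) y∉v)
                                    (trans (∨-identityʳ _) (neighbours-intro R W Wx Rxy))
          where
          y∉v = singleton-other (v≢y ∘ sym)
          x~y = proj₂ (∧-true {a = s y} sy∧x~y)
          Rxy : R x y ≡ true
          Rxy = cong₂ _∧_ (cong₂ _∧_ (proj₁ (∧-true {a = s y} sy∧x~y))
                                     (cong₂ _∧_ (≡⇒inClass (other-end x~y (K-colour (W⊆K x Wx)))) (cong not y∉v))) x~y

      matching = hall K R hall-condition
      open Matching matching renaming (partner to φ)
      leaves : ∀ {x y} → K x ≡ true → R x y ≡ true → Adj G x y × K y ≡ false
      leaves {y = y} _ Rxy = let (S′y , x~y) = ∧-true Rxy in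
        x~y , cong (λ a → not a ∧ not (inClass b y)) (proj₁ (∧-true S′y))
      open MatchingImage G matching leaves renaming (image to Im)

      Im⊆S′ : ∀ {j} → Im j ≡ true → S′ j ≡ true
      Im⊆S′ im = subst (λ z → S′ z ≡ true) (φ-preimage im) (proj₁ (∧-true (related _ (preimage∈X im))))

      outside-K : ∀ {i j} → K i ≡ false → Adj G i j → s j ≡ true → inClass b j ≡ true → ⊥
      outside-K {i} {j} Ki i~j sj bj with s i in si | inClass b i in bi
      ... | true | _ = independent⇒ᵇ G (proj₁ maxS) i j si sj i~j
      ... | false | true = proj₂ bipartite i j i~j (trans (inClass⇒≡ bi) (sym (inClass⇒≡ bj)))
      ... | false | false with () ← Ki

      S′⇒S∩class : ∀ {j} → S′ j ≡ true → s j ≡ true × inClass b j ≡ true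
      S′⇒S∩class S′j = let (sj , rest) = ∧-true S′j in sj , proj₁ (∧-true rest)

      Im-v : Im v ≡ false
      Im-v with Im v in im
      ... | false = refl
      ... | true with () ← trans (sym (singleton-self v))
                           (not≡true⇒≡false (proj₂ (∧-true {a = inClass b v} (proj₂ (∧-true {a = s v} (Im⊆S′ im))))))

      eᵥ : Fin n → ℚ
      eᵥ j = if singleton v j then 1ℚ else 0ℚ

      null-vector : ∀ {w} → (∀ j → Im j ≡ false → w j ≡ 0ℚ) → (∀ i → K i ≡ true → (adjMatrix G · w) i ≡ - adjMatrix G i v) →
        InSupp G v
      null-vector {w} w-off Aw = z , z-null , λ z-v≡0 → ℚ.1≢0 (trans (sym z-v≡1) z-v≡0)
        where
        z : Fin n → ℚ
        z j = w j + eᵥ j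
        z-v≡1 : z v ≡ 1ℚ
        z-v≡1 = trans (cong₂ _+_ (w-off v Im-v) (cong (if_then 1ℚ else 0ℚ) (singleton-self v))) (ℚ.+-identityˡ 1ℚ)
        K-row : ∀ {i} → K i ≡ true → (adjMatrix G · z) i ≡ 0ℚ
        K-row {i} Ki = begin
          (adjMatrix G · z) i
            ≡⟨ sumℚ-cong (λ j → ℚ.*-distribˡ-+ (adjMatrix G i j) (w j) (eᵥ j)) ⟩
          sumℚ (λ j → adjMatrix G i j * w j + adjMatrix G i j * eᵥ j)
            ≡⟨ sumℚ-+ (λ j → adjMatrix G i j * w j) (λ j → adjMatrix G i j * eᵥ j) ⟩
          (adjMatrix G · w) i + (adjMatrix G · eᵥ) i
            ≡⟨ cong₂ _+_ (Aw i Ki) (sumℚ-single (λ j → adjMatrix G i j * eᵥ j) v off-v) ⟩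
          - adjMatrix G i v + adjMatrix G i v * eᵥ v
            ≡⟨ cong (λ e → - adjMatrix G i v + adjMatrix G i v * e) (cong (if_then 1ℚ else 0ℚ) (singleton-self v)) ⟩
          - adjMatrix G i v + adjMatrix G i v * 1ℚ
            ≡⟨ cong (- adjMatrix G i v +_) (ℚ.*-identityʳ (adjMatrix G i v)) ⟩
          - adjMatrix G i v + adjMatrix G i v
            ≡⟨ ℚ.+-inverseˡ (adjMatrix G i v) ⟩
          0ℚ ∎
          where
          open ≡-Reasoning
          off-v : ∀ j → j ≢ v → adjMatrix G i j * eᵥ j ≡ 0ℚ
          off-v j j≢v = trans (cong (λ e → adjMatrix G i j * (if e then 1ℚ else 0ℚ)) (singleton-other j≢v))
                              (ℚ.*-zeroʳ (adjMatrix G i j))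
        other-row : ∀ {i} → K i ≡ false → (adjMatrix G · z) i ≡ 0ℚ
        other-row {i} Ki = sumℚ-zero (λ j → trans (adjMatrix-*-cong G {x = z} {y = λ _ → 0ℚ} (zj≡0 j)) (ℚ.*-zeroʳ (adjMatrix G i j)))
          where
          zj≡0 : ∀ j → Adj G i j → z j ≡ 0ℚ
          zj≡0 j i~j = trans (cong₂ _+_ (w-off j Im-j) (cong (if_then 1ℚ else 0ℚ) (singleton-other j≢v))) (ℚ.+-identityˡ 0ℚ)
            where
            Im-j : Im j ≡ false
            Im-j with Im j in im
            ... | false = refl
            ... | true = let (sj , bj) = S′⇒S∩class (Im⊆S′ im) in ⊥-elim (outside-K Ki i~j sj bj)
            j≢v : j ≢ v
            j≢v refl = outside-K Ki i~j (∈⇒lookup v∈S) (≡⇒inClass refl)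
        z-null : InNull G z
        z-null i = [ K-row , other-row ]′ (true-or-false (K i))

    core∩maximum≡∅ : ∀ {T} → MaximumIndependent G T → ∀ {v} → InCore G v → v ∉ T
    core∩maximum≡∅ maxT (u , v~u , u-supp) v∈T = proj₁ maxT _ u v∈T (supp⊆maximum maxT u-supp) v~u

    unique⇒equalsCS : HasUniqueMaximumIndependentSet G → EqualsCS G
    unique⇒equalsCS (S , maxS , unique) v with v ∈? S
    ... | yes v∈S = inj₁ (unique-maximum⊆supp maxS unique v∈S)
    ... | no v∉S = let (u , u∈S , v~u) = maximum⇒dominating G maxS v∉S in
                   inj₂ (u , v~u , unique-maximum⊆supp maxS unique u∈S)

    equalsCS⇒unique : EqualsCS G → HasUniqueMaximumIndependentSet G
    equalsCS⇒unique supp∪core = S , maxS , λ T maxT → ⊆-antisym (agree maxT maxS) (agree maxS maxT)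
      where
      S = proj₁ (maximumIndependent G)
      maxS = proj₂ (maximumIndependent G)
      agree : ∀ {T U} → MaximumIndependent G T → MaximumIndependent G U → ∀ {v} → v ∈ T → v ∈ U
      agree maxT maxU {v} v∈T with supp∪core v
      ... | inj₁ v-supp = supp⊆maximum maxU v-supp
      ... | inj₂ v-core = ⊥-elim (core∩maximum≡∅ maxT v-core v∈T)

open SupportAndCore

corollary6p7 : ∀ {n : ℕ} (G : Graph n) → Bipartite G → C4kFree G →
    (HasUniqueMaximumIndependentSet G ⇔ EqualsCS G)
corollary6p7 G bipartite c4k-free = mk⇔ (unique⇒equalsCS G bipartite c4k-free) (equalsCS⇒unique G bipartite c4k-free)
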